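{- Let $d\geq 2$. For integers $r\geq -1$ and $k\geq 1$ let $\mathcal{U}(r,k)$ be the number of distinct complete proper $(r,k,d)$-graphs, and set $\mathcal{U}(r,0)=1$. Define the formal power series $E(X;r)=\sum_{k=0}^\infty \frac{\mathcal{U}(r,k)}{k!}X^k$. Then for every $r\geq 0$, $$E(X;r)=\frac{E(X;r-1)^d+d-1}{d}.$$
   Context: An $(r,k,d)$-graph is a graph $G$ with vertex set $\{1,\dots,k\}$ together with, for each edge $\overline{ab}$, values $\xi_G(a,b),\xi_G(b,a)\in\{ -1,\dots,r\}$ and $\eta_G(a,b),\eta_G(b,a)\in\{0,\dots,d-1\}$ such that $\xi_G(a,b)=\xi_G(b,a)$, $\eta_G(a,b)+\eta_G(b,a)\equiv 0\pmod d$, $\eta=0$ when $\xi=-1$, and $\eta\in\{1,\dots,d-1\}$ when $\xi\geq 0$. Two such graphs are distinct if they differ in their edge sets or in some value of $\xi$ or $\eta$. Complete: every pair of distinct vertices is joined. Proper: for all distinct vertices $a,b,c$ with $\overline{ab},\overline{ac},\overline{bc}$ edges: (1) if $\xi_G(a,b)=\xi_G(b,c)=-1$ then $\xi_G(a,c)=-1$; (2) if $\xi_G(a,b)<\xi_G(b,c)$ then $\xi_G(a,c)=\xi_G(b,c)$ and $\eta_G(a,c)=\eta_G(b,c)$; (3) if $0\leq\xi_G(a,b)=\xi_G(b,c)$ and $\eta_G(a,b)+\eta_G(b,c)\neq d$ then $\xi_G(a,c)=\xi_G(a,b)$ and $\eta_G(a,c)\equiv\eta_G(a,b)+\eta_G(b,c)\pmod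 d$; (4) if $0\leq\xi_G(a,b)=\xi_G(b,c)$ and $\eta_G(a,b)+\eta_G(b,c)=d$ then $\xi_G(a,c)<\xi_G(a,b)$. -}

module Defs where

open import Data.Nat using (ℕ; zero; suc; _+_; _<_; _!; NonZero)
open import Data.Nat.Properties using (_!≢0)
import Data.Nat.Properties as ℕP
open import Data.Nat.DivMod using (_%_)
open import Data.Fin using (Fin; toℕ)
import Data.Fin as F
open import Data.Fin.Properties using (all?)
import Data.Fin.Properties as FP
open import Data.Product using (_×_; _,_; proj₁; proj₂)
open import Data.List using (List; allFin; []; _∷_; map; concatMap; filter; length; cartesianProduct)
open import Relation.Binary.PropositionalEquality using (_≡_; _≢_)
open import Relation.Nullary using (¬_; Dec; ¬?)
open import Relation.Nullary.Decidable using (_×-dec_; _→-dec_)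
open import Data.Integer using (+_)
open import Data.Rational using (ℚ; 0ℚ; 1ℚ; _/_) renaming (_+_ to _+ℚ_; _*_ to _*ℚ_)

-- Index convention: the paper's parameter r ≥ -1 is encoded by s = r + 1 ∈ ℕ.
-- A ξ-value in {-1,…,r} is encoded by an element x of Fin (suc s) = Fin (r+2),
-- representing the value toℕ x - 1; so `zero` encodes ξ = -1, and
-- "ξ ≥ 0" is "x ≢ zero"; the order on ξ-values is the order of toℕ.
--
-- A complete graph has every pair of distinct vertices joined, so a complete
-- (r,k,d)-graph is exactly the data ξ(a,b), η(a,b) for all ordered pairs
-- a ≠ b of vertices in Fin k (vertices 1..k encoded by Fin k).  To obtain a
-- unique representative of each graph, the (meaningless) diagonal values
-- are required to be (zero , zero).

XiFun : ℕ → ℕ → Set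
XiFun s k = Fin k → Fin k → Fin (suc s)

EtaFun : ℕ → ℕ → Set
EtaFun d k = Fin k → Fin k → Fin d

PairOK : (s d : ℕ) .{{_ : NonZero d}} (k : ℕ) → XiFun s k → EtaFun d k → Fin k → Fin k → Set
PairOK s d k ξ η a b =
  (a ≢ b → ξ a b ≡ ξ b a) ×
  (a ≢ b → (toℕ (η a b) + toℕ (η b a)) % d ≡ 0) ×
  (a ≢ b → ξ a b ≡ F.zero → toℕ (η a b) ≡ 0) ×
  (a ≢ b → ¬ (ξ a b ≡ F.zero) → ¬ (toℕ (η a b) ≡ 0)) ×
  (a ≡ b → ξ a b ≡ F.zero) ×
  (a ≡ b → toℕ (η a b) ≡ 0)

Distinct3 : {k : ℕ} → Fin k → Fin k → Fin k → Set
Distinct3 a b c = (a ≢ b) × (a ≢ c) × (b ≢ c)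

TripleOK : (s d : ℕ) .{{_ : NonZero d}} (k : ℕ) → XiFun s k → EtaFun d k → Fin k → Fin k → Fin k → Set
TripleOK s d k ξ η a b c =
  Distinct3 a b c →
  ((ξ a b ≡ F.zero → ξ b c ≡ F.zero → ξ a c ≡ F.zero) ×
   (toℕ (ξ a b) < toℕ (ξ b c) → (ξ a c ≡ ξ b c) × (η a c ≡ η b c)) ×
   (¬ (ξ a b ≡ F.zero) → ξ a b ≡ ξ b c → ¬ (toℕ (η a b) + toℕ (η b c) ≡ d) →
      (ξ a c ≡ ξ a b) × (toℕ (η a c) ≡ (toℕ (η a b) + toℕ (η b c)) % d)) ×
   (¬ (ξ a b ≡ F.zero) → ξ a b ≡ ξ b c → toℕ (η a b) + toℕ (η b c) ≡ d →
      toℕ (ξ a c) < toℕ (ξ a b)))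

IsCompleteProper : (s d : ℕ) .{{_ : NonZero d}} (k : ℕ) → XiFun s k × EtaFun d k → Set
IsCompleteProper s d k (ξ , η) =
  (∀ a b → PairOK s d k ξ η a b) × (∀ a b c → TripleOK s d k ξ η a b c)

isCompleteProper? : (s d : ℕ) .{{_ : NonZero d}} (k : ℕ) → (G : XiFun s k × EtaFun d k) → Dec (IsCompleteProper s d k G)
isCompleteProper? s d k (ξ , η) =
  all? (λ a → all? (λ b → pair? a b)) ×-dec
  all? (λ a → all? (λ b → all? (λ c → triple? a b c)))
  where
  ne? : (a b : Fin k) → Dec (a ≢ b)
  ne? a b = ¬? (a FP.≟ b)
  pair? : ∀ a b → Dec (PairOK s d k ξ η a b)
  pair? a b =
    (ne? a b →-dec ξ a b FP.≟ ξ b a) ×-dec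
    (ne? a b →-dec ((toℕ (η a b) + toℕ (η b a)) % d ℕP.≟ 0)) ×-dec
    (ne? a b →-dec (ξ a b FP.≟ F.zero →-dec toℕ (η a b) ℕP.≟ 0)) ×-dec
    (ne? a b →-dec (¬? (ξ a b FP.≟ F.zero) →-dec ¬? (toℕ (η a b) ℕP.≟ 0))) ×-dec
    ((a FP.≟ b) →-dec ξ a b FP.≟ F.zero) ×-dec
    ((a FP.≟ b) →-dec toℕ (η a b) ℕP.≟ 0)
  triple? : ∀ a b c → Dec (TripleOK s d k ξ η a b c)
  triple? a b c =
    (ne? a b ×-dec ne? a c ×-dec ne? b c) →-dec
    ((ξ a b FP.≟ F.zero →-dec ξ b c FP.≟ F.zero →-dec ξ a c FP.≟ F.zero) ×-dec
     (toℕ (ξ a b) ℕP.<? toℕ (ξ b c) →-dec (ξ a c FP.≟ ξ b c ×-dec η a c FP.≟ η b c)) ×-dec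
     (¬? (ξ a b FP.≟ F.zero) →-dec ξ a b FP.≟ ξ b c →-dec ¬? (toℕ (η a b) + toℕ (η b c) ℕP.≟ d) →-dec
        (ξ a c FP.≟ ξ a b ×-dec toℕ (η a c) ℕP.≟ (toℕ (η a b) + toℕ (η b c)) % d)) ×-dec
     (¬? (ξ a b FP.≟ F.zero) →-dec ξ a b FP.≟ ξ b c →-dec toℕ (η a b) + toℕ (η b c) ℕP.≟ d →-dec
        toℕ (ξ a c) ℕP.<? toℕ (ξ a b)))

consF : {A : Set} {k : ℕ} → A → (Fin k → A) → Fin (suc k) → A
consF x f F.zero = x
consF x f (F.suc i) = f i

allFuns : {A : Set} (k : ℕ) → List A → List (Fin k → A)
allFuns zero xs = (λ ()) ∷ []
allFuns (suc k) xs = concatMap (λ f → map (λ x → consF x f) xs) (allFuns k xs)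

allLabellings : (s d k : ℕ) → List (XiFun s k × EtaFun d k)
allLabellings s d k =
  cartesianProduct (allFuns k (allFuns k (allFin (suc s))))
                   (allFuns k (allFuns k (allFin d)))

U : (d : ℕ) .{{_ : NonZero d}} (s k : ℕ) → ℕ
U d s zero = 1
U d s k@(suc _) = length (filter (isCompleteProper? s d k) (allLabellings s d k))

PowerSeries : Set
PowerSeries = ℕ → ℚ

sumTo : ℕ → (ℕ → ℚ) → ℚ
sumTo zero f = f 0
sumTo (suc n) f = sumTo n f +ℚ f (suc n)

_⊕_ : PowerSeries → PowerSeries → PowerSeries
(f ⊕ g) n = f n +ℚ g n

_⊛_ : PowerSeries → PowerSeries → PowerSeries
(f ⊛ g) n = sumTo n (λ i → f i *ℚ g (n Data.Nat.∸ i))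

constPS : ℚ → PowerSeries
constPS c zero = c
constPS c (suc _) = 0ℚ

scalePS : ℚ → PowerSeries → PowerSeries
scalePS c f n = c *ℚ f n

_^PS_ : PowerSeries → ℕ → PowerSeries
f ^PS zero = constPS 1ℚ
f ^PS suc m = f ⊛ (f ^PS m)

E : (d : ℕ) .{{_ : NonZero d}} → ℕ → PowerSeries
E d s k = (+ U d s k / (k !)) {{k !≢0}}

{-# OPTIONS --safe #-}
module Submission where

open import Level using (0ℓ)
open import Function using (_∘_; id)
open import Data.Empty using (⊥-elim)
open import Data.Nat using (ℕ; zero; suc; pred; _+_; _*_; _∸_; _<_; _≤_; _!; NonZero; z≤n; s≤s; >-nonZero⁻¹)
import Data.Nat.Properties as ℕ
open import Data.Nat.Properties using (_!≢0)
open import Data.Nat.DivMod using (_%_; _mod_; m%n<n; %-distribˡ-+; m%n%n≡m%n; m<n⇒m%n≡m; [m+n]%n≡m%n; n%n≡0; m/n*n≡m)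
open import Data.Nat.Combinatorics using (_C_; nCk+nC[k+1]≡[n+1]C[k+1]; k![n∸k]!∣n!; nCn≡1)
open import Data.Nat.Combinatorics.Specification using (nCk≡n!/k![n-k]!; k>n⇒nCk≡0)
open import Data.Nat.Solver using (module +-*-Solver)
open +-*-Solver using (solve; _:+_; _:*_; _:=_; con)
open import Algebra.Properties.CommutativeSemigroup ℕ.+-commutativeSemigroup using (interchange; xy∙z≈y∙xz; x∙yz≈y∙xz)
open import Data.Bool using (Bool; true; false)
import Data.Bool.Properties as Bool
open import Data.Fin using (Fin; toℕ)
import Data.Fin as F
import Data.Fin.Properties as Fin
open import Data.Integer using (+_)
import Data.Integer as ℤ
import Data.Integer.Properties as ℤ
open import Data.Rational using (ℚ; _/_) renaming (_+_ to _+ℚ_; _*_ to _*ℚ_)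
import Data.Rational.Properties as ℚ
import Data.Rational.Unnormalised as ℚᵘ
import Data.Rational.Unnormalised.Properties as ℚᵘ
open import Data.Product using (_×_; _,_; proj₁; proj₂)
open import Data.Product.Relation.Binary.Pointwise.NonDependent using (×-decSetoid)
open import Data.Sum using (_⊎_; inj₁; inj₂; [_,_]; map₁; map₂)
open import Data.Sum.Properties using ([,]-map; [,]-∘; inj₁-injective; inj₂-injective)
open import Data.List using (List; []; _∷_; map; concatMap; concat; filter; length; cartesianProduct; _++_; allFin)
open import Data.List.Properties using (map-tabulate)
open import Data.Vec using (Vec; []; _∷_; lookup; tabulate)
open import Data.Vec.Properties using (lookup∘tabulate)
import Data.Vec.Functional.Relation.Binary.Pointwise.Properties as Pointwise
open import Relation.Binary.Bundles using (DecSetoid)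
open import Relation.Binary.Definitions using (tri<; tri≈; tri>)
open import Relation.Binary.PropositionalEquality
  using (_≡_; _≢_; refl; sym; trans; cong; cong₂; subst; subst₂; module ≡-Reasoning)
open import Relation.Nullary using (¬_; Dec; yes; no; ¬?)
open import Relation.Nullary.Decidable using (_×-dec_; _→-dec_)
open import Defs

-- For j ≥ 0, k! times the k-th coefficient of E(X; r)^j counts the j-coloured proper
-- (r,k,d)-graphs: colourings of the vertices with j colours together with a complete proper graph on
-- each colour class and ξ = -1 between classes (peel off the first colour class: the exponential
-- generating function of a product is the binomial convolution of the coefficients). For k ≥ 1 it
-- then suffices that d·𝒰(r,k) is the number of d-coloured proper (r-1,k,d)-graphs. In a complete
-- proper (r,k,d)-graph, rules (1)-(4) make ξ(a,b) < r an equivalence relation, and across classes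
-- ξ = r and η(a,b) = φ(b) - φ(a) for a colouring φ of the classes by ℤ/d, fixed by its value t at
-- one vertex. Recording t, colouring by φ and replacing the top-level edges by ξ = -1 is a bijection
-- onto the d-coloured proper (r-1,k,d)-graphs. For k = 0 both sides equal 1.

private
  variable
    A B : Set

-- Counting in finite setoids

indicator : {P : Set} → Dec P → ℕ
indicator (yes _) = 1
indicator (no _) = 0

indicator-yes : {P : Set} → P → (p : Dec P) → indicator p ≡ 1
indicator-yes p (yes _) = refl
indicator-yes p (no ¬p) = ⊥-elim (¬p p)

indicator-no : {P : Set} → ¬ P → (p : Dec P) → indicator p ≡ 0
indicator-no ¬p (yes p) = ⊥-elim (¬p p)
indicator-no ¬p (no _) = refl

indicator-⇔ : {P Q : Set} → (P → Q) → (Q → P) → (p : Dec P) (q : Dec Q) → indicator p ≡ indicator q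
indicator-⇔ f g (yes p) q = sym (indicator-yes (f p) q)
indicator-⇔ f g (no ¬p) q = sym (indicator-no (¬p ∘ g) q)

indicator-× : {P Q : Set} (p : Dec P) (q : Dec Q) → indicator (p ×-dec q) ≡ indicator p * indicator q
indicator-× (yes p) (yes q) = refl
indicator-× (yes p) (no ¬q) = refl
indicator-× (no ¬p) q = refl

∑ : {A : Set} → List A → (A → ℕ) → ℕ
∑ [] f = 0
∑ (x ∷ xs) f = f x + ∑ xs f


∑-cong : (xs : List A) {f g : A → ℕ} → (∀ x → f x ≡ g x) → ∑ xs f ≡ ∑ xs g
∑-cong [] e = refl
∑-cong (x ∷ xs) e = cong₂ _+_ (e x) (∑-cong xs e)

∑-0 : (xs : List A) → ∑ xs (λ _ → 0) ≡ 0
∑-0 [] = refl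
∑-0 (x ∷ xs) = ∑-0 xs

∑-+ : (xs : List A) (f g : A → ℕ) → ∑ xs (λ x → f x + g x) ≡ ∑ xs f + ∑ xs g
∑-+ [] f g = refl
∑-+ (x ∷ xs) f g = trans (cong (_+_ (f x + g x)) (∑-+ xs f g)) (interchange (f x) (g x) _ _)

∑-*ˡ : (xs : List A) (c : ℕ) (f : A → ℕ) → ∑ xs (λ x → c * f x) ≡ c * ∑ xs f
∑-*ˡ [] c f = sym (ℕ.*-zeroʳ c)
∑-*ˡ (x ∷ xs) c f = trans (cong (_+_ (c * f x)) (∑-*ˡ xs c f)) (sym (ℕ.*-distribˡ-+ c (f x) (∑ xs f)))

∑-*ʳ : (xs : List A) (c : ℕ) (f : A → ℕ) → ∑ xs (λ x → f x * c) ≡ ∑ xs f * c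
∑-*ʳ xs c f = trans (∑-cong xs (λ x → ℕ.*-comm (f x) c)) (trans (∑-*ˡ xs c f) (ℕ.*-comm c (∑ xs f)))

∑-++ : (xs ys : List A) (f : A → ℕ) → ∑ (xs ++ ys) f ≡ ∑ xs f + ∑ ys f
∑-++ [] ys f = refl
∑-++ (x ∷ xs) ys f = trans (cong (_+_ (f x)) (∑-++ xs ys f)) (sym (ℕ.+-assoc (f x) (∑ xs f) (∑ ys f)))

∑-concat : (xss : List (List A)) (f : A → ℕ) → ∑ (concat xss) f ≡ ∑ xss (λ xs → ∑ xs f)
∑-concat [] f = refl
∑-concat (xs ∷ xss) f = trans (∑-++ xs (concat xss) f) (cong (_+_ (∑ xs f)) (∑-concat xss f))

length-filter : {P : A → Set} (P? : ∀ x → Dec (P x)) (xs : List A) →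
  length (filter P? xs) ≡ ∑ xs (λ x → indicator (P? x))
length-filter P? [] = refl
length-filter P? (x ∷ xs) with P? x
... | yes _ = cong suc (length-filter P? xs)
... | no _ = length-filter P? xs


∑-swap : (xs : List A) (ys : List B) (f : A → B → ℕ) →
  ∑ xs (λ x → ∑ ys (f x)) ≡ ∑ ys (λ y → ∑ xs (λ x → f x y))
∑-swap [] ys f = sym (∑-0 ys)
∑-swap (x ∷ xs) ys f =
  trans (cong (_+_ (∑ ys (f x))) (∑-swap xs ys f)) (sym (∑-+ ys (f x) (λ y → ∑ xs (λ x → f x y))))

∑-map : (xs : List A) (g : A → B) (f : B → ℕ) → ∑ (map g xs) f ≡ ∑ xs (f ∘ g)
∑-map [] g f = refl
∑-map (x ∷ xs) g f = cong (_+_ (f (g x))) (∑-map xs g f)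

∑-cartesianProduct : (xs : List A) (ys : List B) (h : A × B → ℕ) →
  ∑ (cartesianProduct xs ys) h ≡ ∑ xs (λ x → ∑ ys (λ y → h (x , y)))
∑-cartesianProduct [] ys h = refl
∑-cartesianProduct (x ∷ xs) ys h =
  trans (∑-++ (map (x ,_) ys) _ h) (cong₂ _+_ (∑-map ys (x ,_) h) (∑-cartesianProduct xs ys h))

∑-cartesianProduct-* : (xs : List A) (ys : List B) (f : A → ℕ) (g : B → ℕ) →
  ∑ (cartesianProduct xs ys) (λ p → f (proj₁ p) * g (proj₂ p)) ≡ ∑ xs f * ∑ ys g
∑-cartesianProduct-* xs ys f g =
  trans (∑-cartesianProduct xs ys _) (trans (∑-cong xs (λ x → ∑-*ˡ ys (f x) g)) (∑-*ʳ xs (∑ ys g) f))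

∑-concatMap : (xs : List A) (g : A → List B) (f : B → ℕ) →
  ∑ (concatMap g xs) f ≡ ∑ xs (λ x → ∑ (g x) f)
∑-concatMap xs g f = trans (∑-concat (map g xs) f) (∑-map xs g (λ ys → ∑ ys f))

∑-allFin-suc : ∀ n (h : Fin (suc n) → ℕ) → ∑ (allFin (suc n)) h ≡ h F.zero + ∑ (allFin n) (h ∘ F.suc)
∑-allFin-suc n h =
  cong (_+_ (h F.zero)) (trans (cong (λ xs → ∑ xs h) (sym (map-tabulate id F.suc))) (∑-map (allFin n) F.suc h))

∑-allFin-1 : ∀ n → ∑ (allFin n) (λ _ → 1) ≡ n
∑-allFin-1 zero = refl
∑-allFin-1 (suc n) = trans (∑-allFin-suc n (λ _ → 1)) (cong suc (∑-allFin-1 n))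

record FiniteSetoid : Set₁ where
  field
    decSetoid : DecSetoid 0ℓ 0ℓ
  open DecSetoid decSetoid public
  field
    elements : List Carrier
    elements-exact : ∀ x → ∑ elements (λ y → indicator (x ≟ y)) ≡ 1

module _ (S : FiniteSetoid) where
  open FiniteSetoid S using (Carrier; _≈_; _≟_; elements; elements-exact)

  count : {P : Carrier → Set} → (∀ x → Dec (P x)) → ℕ
  count P? = ∑ elements (λ x → indicator (P? x))

  ∑-indicator-≈ : (w : Carrier → ℕ) → (∀ {x y} → x ≈ y → w x ≡ w y) →
    ∀ x → ∑ elements (λ y → indicator (x ≟ y) * w y) ≡ w x
  ∑-indicator-≈ w w-resp x =
    trans (∑-cong elements weight-at-x)
      (trans (∑-*ʳ elements (w x) _) (trans (cong (_* w x) (elements-exact x)) (ℕ.+-identityʳ (w x))))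
    where
    weight-at-x : ∀ y → indicator (x ≟ y) * w y ≡ indicator (x ≟ y) * w x
    weight-at-x y with x ≟ y
    ... | yes x≈y = cong (1 *_) (w-resp (FiniteSetoid.sym S x≈y))
    ... | no _ = refl

count-bijection : (S T : FiniteSetoid) →
  let module S = FiniteSetoid S; module T = FiniteSetoid T in
  {P : S.Carrier → Set} (P? : ∀ x → Dec (P x)) {Q : T.Carrier → Set} (Q? : ∀ y → Dec (Q y)) →
  (∀ {x x'} → x S.≈ x' → P x → P x') → (∀ {y y'} → y T.≈ y' → Q y → Q y') →
  (f : S.Carrier → T.Carrier) (g : T.Carrier → S.Carrier) →
  (∀ {x x'} → x S.≈ x' → f x T.≈ f x') → (∀ {y y'} → y T.≈ y' → g y S.≈ g y') →
  (∀ x → P x → Q (f x)) → (∀ x → P x → g (f x) S.≈ x) →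
  (∀ y → Q y → P (g y)) → (∀ y → Q y → f (g y) T.≈ y) →
  count S P? ≡ count T Q?
count-bijection S T {P} P? {Q} Q? P-resp Q-resp f g f-resp g-resp P⇒Q gf≈ Q⇒P fg≈ =
  trans (∑-cong S.elements (λ x → sym (∑-indicator-≈ T (λ _ → indicator (P? x)) (λ _ → refl) (f x))))
    (trans (∑-swap S.elements T.elements (λ x y → indicator (f x T.≟ y) * indicator (P? x)))
      (∑-cong T.elements fibre-size))
  where
  module S = FiniteSetoid S
  module T = FiniteSetoid T
  fibre-size : ∀ y → ∑ S.elements (λ x → indicator (f x T.≟ y) * indicator (P? x)) ≡ indicator (Q? y)
  fibre-size y with Q? y
  ... | yes q = trans (∑-cong S.elements term)
                  (trans (∑-indicator-≈ S (λ x → indicator (P? x)) P-indicator-resp (g y))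
                         (indicator-yes (Q⇒P y q) (P? (g y))))
    where
    P-indicator-resp : ∀ {x x'} → x S.≈ x' → indicator (P? x) ≡ indicator (P? x')
    P-indicator-resp e = indicator-⇔ (P-resp e) (P-resp (S.sym e)) (P? _) (P? _)
    term : ∀ x → indicator (f x T.≟ y) * indicator (P? x) ≡ indicator (g y S.≟ x) * indicator (P? x)
    term x with P? x
    ... | no _ = trans (ℕ.*-zeroʳ (indicator (f x T.≟ y))) (sym (ℕ.*-zeroʳ (indicator (g y S.≟ x))))
    ... | yes px = cong (_* 1) (indicator-⇔ (λ e → S.trans (g-resp (T.sym e)) (gf≈ x px))
                                           (λ e → T.trans (f-resp (S.sym e)) (fg≈ y q)) (f x T.≟ y) (g y S.≟ x))
  ... | no ¬q = trans (∑-cong S.elements term) (∑-0 S.elements)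
    where
    term : ∀ x → indicator (f x T.≟ y) * indicator (P? x) ≡ 0
    term x with P? x
    ... | no _ = ℕ.*-zeroʳ (indicator (f x T.≟ y))
    ... | yes px = cong (_* 1) (indicator-no (λ e → ¬q (Q-resp e (P⇒Q x px))) (f x T.≟ y))

finiteFin : ℕ → FiniteSetoid
finiteFin n = record
  { decSetoid = Fin.≡-decSetoid n ; elements = allFin n ; elements-exact = exact n }
  where
  exact : ∀ n (x : Fin n) → ∑ (allFin n) (λ y → indicator (x Fin.≟ y)) ≡ 1
  exact (suc n) F.zero = trans (∑-allFin-suc n (λ y → indicator (F.zero Fin.≟ y))) (cong suc
                           (trans (∑-cong (allFin n) (λ y → indicator-no (λ ()) (F.zero Fin.≟ F.suc y))) (∑-0 (allFin n))))
  exact (suc n) (F.suc x) = trans (∑-allFin-suc n (λ y → indicator (F.suc x Fin.≟ y)))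
    (trans (∑-cong (allFin n) (λ y → indicator-⇔ Fin.suc-injective (cong F.suc) (F.suc x Fin.≟ F.suc y) (x Fin.≟ y)))
      (exact n x))

finiteBool : FiniteSetoid
finiteBool = record
  { decSetoid = Bool.≡-decSetoid ; elements = true ∷ false ∷ [] ; elements-exact = exact }
  where
  exact : ∀ x → ∑ (true ∷ false ∷ []) (λ y → indicator (x Bool.≟ y)) ≡ 1
  exact true = refl
  exact false = refl

_×ᶠ_ : FiniteSetoid → FiniteSetoid → FiniteSetoid
S ×ᶠ T = record
  { decSetoid = ×-decSetoid S.decSetoid T.decSetoid
  ; elements = cartesianProduct S.elements T.elements
  ; elements-exact = exact }
  where
  module S = FiniteSetoid S
  module T = FiniteSetoid T
  open ≡-Reasoning
  exact : ∀ p → ∑ (cartesianProduct S.elements T.elements)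
                  (λ q → indicator ((proj₁ p S.≟ proj₁ q) ×-dec (proj₂ p T.≟ proj₂ q))) ≡ 1
  exact (x , y) = begin
    ∑ (cartesianProduct S.elements T.elements) (λ q → indicator ((x S.≟ proj₁ q) ×-dec (y T.≟ proj₂ q)))
      ≡⟨ ∑-cong (cartesianProduct S.elements T.elements) (λ q → indicator-× (x S.≟ proj₁ q) (y T.≟ proj₂ q)) ⟩
    ∑ (cartesianProduct S.elements T.elements) (λ q → indicator (x S.≟ proj₁ q) * indicator (y T.≟ proj₂ q))
      ≡⟨ ∑-cartesianProduct-* S.elements T.elements (λ x' → indicator (x S.≟ x')) (λ y' → indicator (y T.≟ y')) ⟩
    ∑ S.elements (λ x' → indicator (x S.≟ x')) * ∑ T.elements (λ y' → indicator (y T.≟ y'))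
      ≡⟨ cong₂ _*_ (S.elements-exact x) (T.elements-exact y) ⟩
    1 ∎

finiteFun : ℕ → FiniteSetoid → FiniteSetoid
finiteFun k S = record
  { decSetoid = Pointwise.decSetoid S.decSetoid k ; elements = allFuns k S.elements ; elements-exact = exact k }
  where
  module S = FiniteSetoid S
  _≟ᶠ_ : ∀ {k} (f g : Fin k → S.Carrier) → Dec (∀ i → f i S.≈ g i)
  f ≟ᶠ g = Fin.all? (λ i → f i S.≟ g i)
  exact : ∀ k (f : Fin k → S.Carrier) → ∑ (allFuns k S.elements) (λ g → indicator (f ≟ᶠ g)) ≡ 1
  exact zero f = refl
  exact (suc k) f =
    trans (∑-concatMap (allFuns k S.elements) (λ g → map (λ x → consF x g) S.elements) _)
      (trans (∑-cong (allFuns k S.elements) extend) (exact k (f ∘ F.suc)))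
    where
    open ≡-Reasoning
    split : ∀ x g → (∀ i → f i S.≈ consF x g i) → (f F.zero S.≈ x) × (∀ i → f (F.suc i) S.≈ g i)
    split x g e = e F.zero , e ∘ F.suc
    join : ∀ x g → (f F.zero S.≈ x) × (∀ i → f (F.suc i) S.≈ g i) → ∀ i → f i S.≈ consF x g i
    join x g (e , _) F.zero = e
    join x g (_ , e) (F.suc i) = e i
    extend : ∀ g → ∑ (map (λ x → consF x g) S.elements) (λ h → indicator (f ≟ᶠ h))
                   ≡ indicator ((f ∘ F.suc) ≟ᶠ g)
    extend g = begin
      ∑ (map (λ x → consF x g) S.elements) (λ h → indicator (f ≟ᶠ h))
        ≡⟨ ∑-map S.elements (λ x → consF x g) _ ⟩
      ∑ S.elements (λ x → indicator (f ≟ᶠ consF x g))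
        ≡⟨ ∑-cong S.elements (λ x → trans (indicator-⇔ (split x g) (join x g) (f ≟ᶠ consF x g) (head? x ×-dec tail?))
                                           (indicator-× (head? x) tail?)) ⟩
      ∑ S.elements (λ x → indicator (head? x) * indicator tail?)
        ≡⟨ ∑-*ʳ S.elements (indicator tail?) (λ x → indicator (head? x)) ⟩
      ∑ S.elements (λ x → indicator (head? x)) * indicator tail?
        ≡⟨ cong (_* indicator tail?) (S.elements-exact (f F.zero)) ⟩
      1 * indicator tail?
        ≡⟨ ℕ.*-identityˡ _ ⟩
      indicator tail? ∎
      where
      head? = λ x → f F.zero S.≟ x
      tail? = (f ∘ F.suc) ≟ᶠ g

-- Arithmetic modulo d

module ZMod (d : ℕ) .{{_ : NonZero d}} where
  open ≡-Reasoning

  infixl 6 _+ₘ_ _-ₘ_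

  _+ₘ_ : Fin d → Fin d → Fin d
  a +ₘ b = (toℕ a + toℕ b) mod d

  _-ₘ_ : Fin d → Fin d → Fin d
  b -ₘ a = (toℕ b + (d ∸ toℕ a)) mod d

  toℕ-mod : ∀ m → toℕ (m mod d) ≡ m % d
  toℕ-mod m = Fin.toℕ-fromℕ< (m%n<n m d)

  0ₘ : Fin d
  0ₘ = 0 mod d

  toℕ-0ₘ : toℕ 0ₘ ≡ 0
  toℕ-0ₘ = trans (toℕ-mod 0) (m<n⇒m%n≡m (>-nonZero⁻¹ d))

  toℕ-% : ∀ (x : Fin d) → toℕ x % d ≡ toℕ x
  toℕ-% x = m<n⇒m%n≡m (Fin.toℕ<n x)

  [m%d+n]%d≡[m+n]%d : ∀ m n → (m % d + n) % d ≡ (m + n) % d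
  [m%d+n]%d≡[m+n]%d m n = begin
    (m % d + n) % d          ≡⟨ %-distribˡ-+ (m % d) n d ⟩
    (m % d % d + n % d) % d  ≡⟨ cong (λ z → (z + n % d) % d) (m%n%n≡m%n m d) ⟩
    (m % d + n % d) % d      ≡⟨ sym (%-distribˡ-+ m n d) ⟩
    (m + n) % d              ∎

  [m+n%d]%d≡[m+n]%d : ∀ m n → (m + n % d) % d ≡ (m + n) % d
  [m+n%d]%d≡[m+n]%d m n = begin
    (m + n % d) % d  ≡⟨ cong (_% d) (ℕ.+-comm m (n % d)) ⟩
    (n % d + m) % d  ≡⟨ [m%d+n]%d≡[m+n]%d n m ⟩
    (n + m) % d      ≡⟨ cong (_% d) (ℕ.+-comm n m) ⟩
    (m + n) % d      ∎

  x+[d∸x]≡d : ∀ (x : Fin d) → toℕ x + (d ∸ toℕ x) ≡ d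
  x+[d∸x]≡d x = ℕ.m+[n∸m]≡n (ℕ.<⇒≤ (Fin.toℕ<n x))

  [x+d]%d≡x : ∀ (x : Fin d) → (toℕ x + d) % d ≡ toℕ x
  [x+d]%d≡x x = trans ([m+n]%n≡m%n (toℕ x) d) (toℕ-% x)

  [t+e]-t≡e : ∀ t e → (t +ₘ e) -ₘ t ≡ e
  [t+e]-t≡e t e = Fin.toℕ-injective (begin
    toℕ ((t +ₘ e) -ₘ t)                        ≡⟨ toℕ-mod _ ⟩
    (toℕ (t +ₘ e) + (d ∸ toℕ t)) % d           ≡⟨ cong (λ z → (z + (d ∸ toℕ t)) % d) (toℕ-mod _) ⟩
    ((toℕ t + toℕ e) % d + (d ∸ toℕ t)) % d    ≡⟨ [m%d+n]%d≡[m+n]%d _ _ ⟩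
    (toℕ t + toℕ e + (d ∸ toℕ t)) % d          ≡⟨ cong (_% d) (xy∙z≈y∙xz (toℕ t) (toℕ e) _) ⟩
    (toℕ e + (toℕ t + (d ∸ toℕ t))) % d        ≡⟨ cong (λ z → (toℕ e + z) % d) (x+[d∸x]≡d t) ⟩
    (toℕ e + d) % d                            ≡⟨ [x+d]%d≡x e ⟩
    toℕ e                                      ∎)

  t+[u-t]≡u : ∀ t u → t +ₘ (u -ₘ t) ≡ u
  t+[u-t]≡u t u = Fin.toℕ-injective (begin
    toℕ (t +ₘ (u -ₘ t))                        ≡⟨ toℕ-mod _ ⟩
    (toℕ t + toℕ (u -ₘ t)) % d                 ≡⟨ cong (λ z → (toℕ t + z) % d) (toℕ-mod _) ⟩
    (toℕ t + (toℕ u + (d ∸ toℕ t)) % d) % d    ≡⟨ [m+n%d]%d≡[m+n]%d _ _ ⟩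
    (toℕ t + (toℕ u + (d ∸ toℕ t))) % d        ≡⟨ cong (_% d) (sym (xy∙z≈y∙xz (toℕ u) (toℕ t) _)) ⟩
    (toℕ u + toℕ t + (d ∸ toℕ t)) % d          ≡⟨ cong (_% d) (ℕ.+-assoc (toℕ u) (toℕ t) _) ⟩
    (toℕ u + (toℕ t + (d ∸ toℕ t))) % d        ≡⟨ cong (λ z → (toℕ u + z) % d) (x+[d∸x]≡d t) ⟩
    (toℕ u + d) % d                            ≡⟨ [x+d]%d≡x u ⟩
    toℕ u                                      ∎)

  +ₘ-cancelˡ : ∀ t x y → t +ₘ x ≡ t +ₘ y → x ≡ y
  +ₘ-cancelˡ t x y e = trans (sym ([t+e]-t≡e t x)) (trans (cong (_-ₘ t) e) ([t+e]-t≡e t y))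

  toℕ[t-t]≡0 : ∀ t → toℕ (t -ₘ t) ≡ 0
  toℕ[t-t]≡0 t = trans (toℕ-mod _) (trans (cong (_% d) (x+[d∸x]≡d t)) (n%n≡0 d))

  t+e≡t⇒e≡0 : ∀ t e → t +ₘ e ≡ t → toℕ e ≡ 0
  t+e≡t⇒e≡0 t e p = trans (cong toℕ (sym ([t+e]-t≡e t e))) (trans (cong (λ z → toℕ (z -ₘ t)) p) (toℕ[t-t]≡0 t))

  u-t≡0⇒u≡t : ∀ u t → toℕ (u -ₘ t) ≡ 0 → u ≡ t
  u-t≡0⇒u≡t u t e = Fin.toℕ-injective (begin
    toℕ u                        ≡⟨ cong toℕ (sym (t+[u-t]≡u t u)) ⟩
    toℕ (t +ₘ (u -ₘ t))          ≡⟨ toℕ-mod _ ⟩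
    (toℕ t + toℕ (u -ₘ t)) % d   ≡⟨ cong (λ z → (toℕ t + z) % d) e ⟩
    (toℕ t + 0) % d              ≡⟨ cong (_% d) (ℕ.+-identityʳ (toℕ t)) ⟩
    toℕ t % d                    ≡⟨ toℕ-% t ⟩
    toℕ t                        ∎)

  -ₘ-telescope : ∀ a b c → toℕ (c -ₘ a) ≡ (toℕ (b -ₘ a) + toℕ (c -ₘ b)) % d
  -ₘ-telescope a b c = sym (begin
    (toℕ (b -ₘ a) + toℕ (c -ₘ b)) % d
      ≡⟨ cong (λ z → (z + toℕ (c -ₘ b)) % d) (toℕ-mod _) ⟩
    ((toℕ b + (d ∸ toℕ a)) % d + toℕ (c -ₘ b)) % d
      ≡⟨ [m%d+n]%d≡[m+n]%d _ _ ⟩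
    ((toℕ b + (d ∸ toℕ a)) + toℕ (c -ₘ b)) % d
      ≡⟨ cong (λ z → ((toℕ b + (d ∸ toℕ a)) + z) % d) (toℕ-mod _) ⟩
    ((toℕ b + (d ∸ toℕ a)) + (toℕ c + (d ∸ toℕ b)) % d) % d
      ≡⟨ [m+n%d]%d≡[m+n]%d _ _ ⟩
    ((toℕ b + (d ∸ toℕ a)) + (toℕ c + (d ∸ toℕ b))) % d
      ≡⟨ cong (_% d) (rearrange (toℕ b) (d ∸ toℕ a) (toℕ c) (d ∸ toℕ b)) ⟩
    ((toℕ c + (d ∸ toℕ a)) + (toℕ b + (d ∸ toℕ b))) % d
      ≡⟨ cong (λ z → ((toℕ c + (d ∸ toℕ a)) + z) % d) (x+[d∸x]≡d b) ⟩
    ((toℕ c + (d ∸ toℕ a)) + d) % d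
      ≡⟨ [m+n]%n≡m%n _ d ⟩
    (toℕ c + (d ∸ toℕ a)) % d
      ≡⟨ sym (toℕ-mod _) ⟩
    toℕ (c -ₘ a) ∎)
    where
    rearrange : ∀ p q r u → (p + q) + (r + u) ≡ (r + q) + (p + u)
    rearrange p q r u = begin
      (p + q) + (r + u)  ≡⟨ interchange p q r u ⟩
      (p + r) + (q + u)  ≡⟨ cong (_+ (q + u)) (ℕ.+-comm p r) ⟩
      (r + p) + (q + u)  ≡⟨ interchange r p q u ⟩
      (r + q) + (p + u)  ∎

  [b-a]+[a-b]≡0 : ∀ a b → (toℕ (b -ₘ a) + toℕ (a -ₘ b)) % d ≡ 0
  [b-a]+[a-b]≡0 a b = trans (sym (-ₘ-telescope a b a)) (toℕ[t-t]≡0 a)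

  [t-[t+e]]+e≡0 : ∀ t e → (toℕ (t -ₘ (t +ₘ e)) + toℕ e) % d ≡ 0
  [t-[t+e]]+e≡0 t e =
    trans (cong (λ z → (toℕ (t -ₘ (t +ₘ e)) + toℕ z) % d) (sym ([t+e]-t≡e t e))) ([b-a]+[a-b]≡0 (t +ₘ e) t)

  x≢0∧[x+y]%d≡0⇒x+y≡d : ∀ (x y : Fin d) → toℕ x ≢ 0 → (toℕ x + toℕ y) % d ≡ 0 → toℕ x + toℕ y ≡ d
  x≢0∧[x+y]%d≡0⇒x+y≡d x y x≢0 e with toℕ x + toℕ y ℕ.<? d
  ... | yes lt = ⊥-elim (x≢0 (ℕ.m+n≡0⇒m≡0 (toℕ x) (trans (sym (m<n⇒m%n≡m lt)) e)))
  ... | no ≮d = trans sum≡r+d (cong (_+ d) r≡0)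
    where
    r = toℕ x + toℕ y ∸ d
    sum≡r+d : toℕ x + toℕ y ≡ r + d
    sum≡r+d = sym (ℕ.m∸n+n≡m (ℕ.≮⇒≥ ≮d))
    r<d : r < d
    r<d = ℕ.+-cancelʳ-< d r d (ℕ.≤-trans (ℕ.≤-reflexive (cong suc (sym sum≡r+d)))
                                (ℕ.+-mono-< (Fin.toℕ<n x) (Fin.toℕ<n y)))
    r≡0 : r ≡ 0
    r≡0 = trans (sym (m<n⇒m%n≡m r<d)) (trans (sym ([m+n]%n≡m%n r d)) (trans (cong (_% d) (sym sum≡r+d)) e))

  inverse-unique : ∀ x y e → x < d → y < d → (x + e) % d ≡ 0 → (y + e) % d ≡ 0 → x ≡ y
  inverse-unique x y e x<d y<d x+e≡0 y+e≡0 = begin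
    x                       ≡⟨ sym (m<n⇒m%n≡m x<d) ⟩
    x % d                   ≡⟨ cong (_% d) (sym (ℕ.+-identityʳ x)) ⟩
    (x + 0) % d             ≡⟨ cong (λ z → (x + z) % d) (sym y+e≡0) ⟩
    (x + (y + e) % d) % d   ≡⟨ [m+n%d]%d≡[m+n]%d x _ ⟩
    (x + (y + e)) % d       ≡⟨ cong (_% d) (x∙yz≈y∙xz x y e) ⟩
    (y + (x + e)) % d       ≡⟨ sym ([m+n%d]%d≡[m+n]%d y _) ⟩
    (y + (x + e) % d) % d   ≡⟨ cong (λ z → (y + z) % d) x+e≡0 ⟩
    (y + 0) % d             ≡⟨ cong (_% d) (ℕ.+-identityʳ y) ⟩
    y % d                   ≡⟨ m<n⇒m%n≡m y<d ⟩
    y                       ∎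

-- Relabelling vertices and levels

toℕ-≡-zero : ∀ {m n} {x : Fin (suc m)} {y : Fin (suc n)} → toℕ x ≡ toℕ y → x ≡ F.zero → y ≡ F.zero
toℕ-≡-zero x≡y refl = Fin.toℕ-injective (sym x≡y)

module _ (d : ℕ) .{{_ : NonZero d}} {s₁ s₂ k₁ k₂ : ℕ}
         (ξ₁ : XiFun s₁ k₁) (η₁ : EtaFun d k₁) (ξ₂ : XiFun s₂ k₂) (η₂ : EtaFun d k₂) where

  PairOK-transport : (a b : Fin k₁) (a' b' : Fin k₂) → (a ≡ b → a' ≡ b') → (a' ≡ b' → a ≡ b) →
    toℕ (ξ₁ a b) ≡ toℕ (ξ₂ a' b') → toℕ (ξ₁ b a) ≡ toℕ (ξ₂ b' a') →
    η₁ a b ≡ η₂ a' b' → η₁ b a ≡ η₂ b' a' →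
    PairOK s₁ d k₁ ξ₁ η₁ a b → PairOK s₂ d k₂ ξ₂ η₂ a' b'
  PairOK-transport a b a' b' to from ξab ξba ηab ηba (sym-ξ , sum-η , η-zero , η-nonzero , diag-ξ , diag-η) =
    (λ a'≢b' → Fin.toℕ-injective (trans (sym ξab) (trans (cong toℕ (sym-ξ (a'≢b' ∘ to))) ξba))) ,
    (λ a'≢b' → subst (λ z → z % d ≡ 0) (cong₂ _+_ (cong toℕ ηab) (cong toℕ ηba)) (sum-η (a'≢b' ∘ to))) ,
    (λ a'≢b' ξ≡0 → trans (cong toℕ (sym ηab)) (η-zero (a'≢b' ∘ to) (toℕ-≡-zero (sym ξab) ξ≡0))) ,
    (λ a'≢b' ξ≢0 η≡0 → η-nonzero (a'≢b' ∘ to) (ξ≢0 ∘ toℕ-≡-zero ξab) (trans (cong toℕ ηab) η≡0)) ,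
    (λ a'≡b' → toℕ-≡-zero ξab (diag-ξ (from a'≡b'))) ,
    (λ a'≡b' → trans (cong toℕ (sym ηab)) (diag-η (from a'≡b')))

  TripleOK-transport : (a b c : Fin k₁) (a' b' c' : Fin k₂) → (Distinct3 a' b' c' → Distinct3 a b c) →
    toℕ (ξ₁ a b) ≡ toℕ (ξ₂ a' b') → toℕ (ξ₁ b c) ≡ toℕ (ξ₂ b' c') →
    toℕ (ξ₁ a c) ≡ toℕ (ξ₂ a' c') →
    η₁ a b ≡ η₂ a' b' → η₁ b c ≡ η₂ b' c' → η₁ a c ≡ η₂ a' c' →
    TripleOK s₁ d k₁ ξ₁ η₁ a b c → TripleOK s₂ d k₂ ξ₂ η₂ a' b' c'
  TripleOK-transport a b c a' b' c' distinct ξab ξbc ξac ηab ηbc ηac T abc-distinct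
    with T (distinct abc-distinct)
  ... | (rule₁ , rule₂ , rule₃ , rule₄) =
    (λ ab≡0 bc≡0 → toℕ-≡-zero ξac (rule₁ (toℕ-≡-zero (sym ξab) ab≡0) (toℕ-≡-zero (sym ξbc) bc≡0))) ,
    (λ ab<bc → let (ac≡bc , ηac≡ηbc) = rule₂ (subst₂ _<_ (sym ξab) (sym ξbc) ab<bc) in
       Fin.toℕ-injective (trans (sym ξac) (trans (cong toℕ ac≡bc) ξbc)) ,
       trans (sym ηac) (trans ηac≡ηbc ηbc)) ,
    (λ ab≢0 ab≡bc sum≢d →
       let (ac≡ab , ηac≡sum) = rule₃ (ab≢0 ∘ toℕ-≡-zero ξab) (ξ₁-≡ ab≡bc) (sum≢d ∘ trans (sym ηsum-≡)) in
       Fin.toℕ-injective (trans (sym ξac) (trans (cong toℕ ac≡ab) ξab)) ,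
       trans (cong toℕ (sym ηac)) (trans ηac≡sum (cong (_% d) ηsum-≡))) ,
    (λ ab≢0 ab≡bc sum≡d →
       subst₂ _<_ ξac ξab (rule₄ (ab≢0 ∘ toℕ-≡-zero ξab) (ξ₁-≡ ab≡bc) (trans ηsum-≡ sum≡d)))
    where
    ηsum-≡ : toℕ (η₁ a b) + toℕ (η₁ b c) ≡ toℕ (η₂ a' b') + toℕ (η₂ b' c')
    ηsum-≡ = cong₂ _+_ (cong toℕ ηab) (cong toℕ ηbc)
    ξ₁-≡ : ξ₂ a' b' ≡ ξ₂ b' c' → ξ₁ a b ≡ ξ₁ b c
    ξ₁-≡ e = Fin.toℕ-injective (trans ξab (trans (cong toℕ e) (sym ξbc)))

reindex : ∀ {m k} → (Fin m → Fin k) → (Fin k → Fin k → A) → Fin m → Fin m → A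
reindex f ξ i j = ξ (f i) (f j)

module _ (d : ℕ) .{{_ : NonZero d}} {s k m : ℕ} (f : Fin m → Fin k) (f-injective : ∀ {i j} → f i ≡ f j → i ≡ j)
         (ξ : XiFun s k) (η : EtaFun d k) where

  PairOK-reindex : ∀ i j → PairOK s d k ξ η (f i) (f j) → PairOK s d m (reindex f ξ) (reindex f η) i j
  PairOK-reindex i j =
    PairOK-transport d ξ η (reindex f ξ) (reindex f η) (f i) (f j) i j f-injective (cong f) refl refl refl refl

  TripleOK-reindex : ∀ i j l → TripleOK s d k ξ η (f i) (f j) (f l) →
                     TripleOK s d m (reindex f ξ) (reindex f η) i j l
  TripleOK-reindex i j l = TripleOK-transport d ξ η (reindex f ξ) (reindex f η) (f i) (f j) (f l) i j l
    (λ (i≢j , i≢l , j≢l) → i≢j ∘ f-injective , i≢l ∘ f-injective , j≢l ∘ f-injective)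
    refl refl refl refl refl refl

module _ (d : ℕ) .{{_ : NonZero d}} {s k : ℕ} where

  IsCompleteProper-resp : {ξ ξ' : XiFun s k} {η η' : EtaFun d k} →
    (∀ a b → ξ a b ≡ ξ' a b) → (∀ a b → η a b ≡ η' a b) →
    IsCompleteProper s d k (ξ , η) → IsCompleteProper s d k (ξ' , η')
  IsCompleteProper-resp {ξ} {ξ'} {η} {η'} eξ eη (pairs , triples) =
    (λ a b → PairOK-transport d ξ η ξ' η' a b a b (λ e → e) (λ e → e) (cong toℕ (eξ a b)) (cong toℕ (eξ b a))
               (eη a b) (eη b a) (pairs a b)) ,
    (λ a b c → TripleOK-transport d ξ η ξ' η' a b c a b c (λ x → x) (cong toℕ (eξ a b)) (cong toℕ (eξ b c))
               (cong toℕ (eξ a c)) (eη a b) (eη b c) (eη a c) (triples a b c))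

-- Proper and coloured labellings

module Coloured (d : ℕ) .{{_ : NonZero d}} where

  Labelling : ℕ → ℕ → Set
  Labelling s k = XiFun s k × EtaFun d k

  labellings : ℕ → ℕ → FiniteSetoid
  labellings s k = finiteFun k (finiteFun k (finiteFin (suc s))) ×ᶠ finiteFun k (finiteFun k (finiteFin d))

  countProper : ℕ → ℕ → ℕ
  countProper s k = count (labellings s k) (isCompleteProper? s d k)

  U≡countProper : ∀ s k → U d s k ≡ countProper s k
  U≡countProper s zero = refl
  U≡countProper s (suc k) = length-filter (isCompleteProper? s d (suc k)) (allLabellings s d (suc k))

  module _ {s k : ℕ} (ξ : XiFun s k) (η : EtaFun d k) where

    pairOK? : ∀ a b → Dec (PairOK s d k ξ η a b)
    pairOK? a b =
      (¬? (a Fin.≟ b) →-dec ξ a b Fin.≟ ξ b a) ×-dec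
      (¬? (a Fin.≟ b) →-dec ((toℕ (η a b) + toℕ (η b a)) % d ℕ.≟ 0)) ×-dec
      (¬? (a Fin.≟ b) →-dec (ξ a b Fin.≟ F.zero →-dec toℕ (η a b) ℕ.≟ 0)) ×-dec
      (¬? (a Fin.≟ b) →-dec (¬? (ξ a b Fin.≟ F.zero) →-dec ¬? (toℕ (η a b) ℕ.≟ 0))) ×-dec
      ((a Fin.≟ b) →-dec ξ a b Fin.≟ F.zero) ×-dec
      ((a Fin.≟ b) →-dec toℕ (η a b) ℕ.≟ 0)

    tripleOK? : ∀ a b c → Dec (TripleOK s d k ξ η a b c)
    tripleOK? a b c =
      (¬? (a Fin.≟ b) ×-dec ¬? (a Fin.≟ c) ×-dec ¬? (b Fin.≟ c)) →-dec
      ((ξ a b Fin.≟ F.zero →-dec ξ b c Fin.≟ F.zero →-dec ξ a c Fin.≟ F.zero) ×-dec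
       (toℕ (ξ a b) ℕ.<? toℕ (ξ b c) →-dec (ξ a c Fin.≟ ξ b c ×-dec η a c Fin.≟ η b c)) ×-dec
       (¬? (ξ a b Fin.≟ F.zero) →-dec ξ a b Fin.≟ ξ b c →-dec ¬? (toℕ (η a b) + toℕ (η b c) ℕ.≟ d) →-dec
          (ξ a c Fin.≟ ξ a b ×-dec toℕ (η a c) ℕ.≟ (toℕ (η a b) + toℕ (η b c)) % d)) ×-dec
       (¬? (ξ a b Fin.≟ F.zero) →-dec ξ a b Fin.≟ ξ b c →-dec toℕ (η a b) + toℕ (η b c) ℕ.≟ d →-dec
          toℕ (ξ a c) ℕ.<? toℕ (ξ a b)))

  IsColouredProper : (s j k : ℕ) → (Fin k → Fin j) × Labelling s k → Set
  IsColouredProper s j k (c , (ξ , η)) =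
    (∀ a b → c a ≡ c b → PairOK s d k ξ η a b) ×
    (∀ a b e → c a ≡ c b → c b ≡ c e → TripleOK s d k ξ η a b e) ×
    (∀ a b → ¬ (c a ≡ c b) → (ξ a b ≡ F.zero) × (toℕ (η a b) ≡ 0))

  isColouredProper? : ∀ s j k → (x : (Fin k → Fin j) × Labelling s k) → Dec (IsColouredProper s j k x)
  isColouredProper? s j k (c , (ξ , η)) =
    Fin.all? (λ a → Fin.all? (λ b → (c a Fin.≟ c b) →-dec pairOK? ξ η a b)) ×-dec
    Fin.all? (λ a → Fin.all? (λ b → Fin.all? (λ e →
      (c a Fin.≟ c b) →-dec ((c b Fin.≟ c e) →-dec tripleOK? ξ η a b e)))) ×-dec
    Fin.all? (λ a → Fin.all? (λ b → ¬? (c a Fin.≟ c b) →-dec (ξ a b Fin.≟ F.zero ×-dec toℕ (η a b) ℕ.≟ 0)))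

  colouredLabellings : ℕ → ℕ → ℕ → FiniteSetoid
  colouredLabellings s j k = finiteFun k (finiteFin j) ×ᶠ labellings s k

  countColoured : ℕ → ℕ → ℕ → ℕ
  countColoured s j k = count (colouredLabellings s j k) (isColouredProper? s j k)

  IsColouredProper-resp : ∀ {s j k} {x y : (Fin k → Fin j) × Labelling s k} →
    FiniteSetoid._≈_ (colouredLabellings s j k) x y → IsColouredProper s j k x → IsColouredProper s j k y
  IsColouredProper-resp {x = c , (ξ , η)} {c' , (ξ' , η')} (ec , (eξ , eη)) (pairs , triples , across) =
    (λ a b e → PairOK-transport d ξ η ξ' η' a b a b (λ z → z) (λ z → z)
        (cong toℕ (eξ a b)) (cong toℕ (eξ b a)) (eη a b) (eη b a) (pairs a b (same-colour e))) ,
    (λ a b e e₁ e₂ → TripleOK-transport d ξ η ξ' η' a b e a b e (λ z → z)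
        (cong toℕ (eξ a b)) (cong toℕ (eξ b e)) (cong toℕ (eξ a e)) (eη a b) (eη b e) (eη a e)
        (triples a b e (same-colour e₁) (same-colour e₂))) ,
    (λ a b c'a≢c'b → let (ξ≡0 , η≡0) = across a b (λ e → c'a≢c'b (trans (sym (ec a)) (trans e (ec b)))) in
       trans (sym (eξ a b)) ξ≡0 , trans (cong toℕ (sym (eη a b))) η≡0)
    where
    same-colour : ∀ {a b} → c' a ≡ c' b → c a ≡ c b
    same-colour {a} {b} e = trans (ec a) (trans e (sym (ec b)))

-- Splitting Fin k along a Boolean vector

countTrue : ∀ {k} → Vec Bool k → ℕ
countTrue [] = 0
countTrue (true ∷ p) = suc (countTrue p)
countTrue (false ∷ p) = countTrue p

countFalse : ∀ {k} → Vec Bool k → ℕ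
countFalse [] = 0
countFalse (true ∷ p) = countFalse p
countFalse (false ∷ p) = suc (countFalse p)

trueAt : ∀ {k} (p : Vec Bool k) → Fin (countTrue p) → Fin k
trueAt (true ∷ p) F.zero = F.zero
trueAt (true ∷ p) (F.suc i) = F.suc (trueAt p i)
trueAt (false ∷ p) i = F.suc (trueAt p i)

falseAt : ∀ {k} (p : Vec Bool k) → Fin (countFalse p) → Fin k
falseAt (false ∷ p) F.zero = F.zero
falseAt (false ∷ p) (F.suc i) = F.suc (falseAt p i)
falseAt (true ∷ p) i = F.suc (falseAt p i)

locate : ∀ {k} (p : Vec Bool k) → Fin k → Fin (countTrue p) ⊎ Fin (countFalse p)
locate (true ∷ p) F.zero = inj₁ F.zero
locate (false ∷ p) F.zero = inj₂ F.zero
locate (true ∷ p) (F.suc a) = map₁ F.suc (locate p a)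
locate (false ∷ p) (F.suc a) = map₂ F.suc (locate p a)

locate-trueAt : ∀ {k} (p : Vec Bool k) i → locate p (trueAt p i) ≡ inj₁ i
locate-trueAt (true ∷ p) F.zero = refl
locate-trueAt (true ∷ p) (F.suc i) = cong (map₁ F.suc) (locate-trueAt p i)
locate-trueAt (false ∷ p) i = cong (map₂ F.suc) (locate-trueAt p i)

locate-falseAt : ∀ {k} (p : Vec Bool k) i → locate p (falseAt p i) ≡ inj₂ i
locate-falseAt (false ∷ p) F.zero = refl
locate-falseAt (false ∷ p) (F.suc i) = cong (map₂ F.suc) (locate-falseAt p i)
locate-falseAt (true ∷ p) i = cong (map₁ F.suc) (locate-falseAt p i)

unlocate-locate : ∀ {k} (p : Vec Bool k) a → [ trueAt p , falseAt p ] (locate p a) ≡ a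
unlocate-locate (true ∷ p) F.zero = refl
unlocate-locate (false ∷ p) F.zero = refl
unlocate-locate (true ∷ p) (F.suc a) =
  trans ([,]-map (locate p a)) (trans (sym ([,]-∘ F.suc (locate p a))) (cong F.suc (unlocate-locate p a)))
unlocate-locate (false ∷ p) (F.suc a) =
  trans ([,]-map (locate p a)) (trans (sym ([,]-∘ F.suc (locate p a))) (cong F.suc (unlocate-locate p a)))

trueAt-locate : ∀ {k} (p : Vec Bool k) {a i} → locate p a ≡ inj₁ i → trueAt p i ≡ a
trueAt-locate p {a} e = trans (cong [ trueAt p , falseAt p ] (sym e)) (unlocate-locate p a)

falseAt-locate : ∀ {k} (p : Vec Bool k) {a i} → locate p a ≡ inj₂ i → falseAt p i ≡ a
falseAt-locate p {a} e = trans (cong [ trueAt p , falseAt p ] (sym e)) (unlocate-locate p a)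

lookup-trueAt : ∀ {k} (p : Vec Bool k) i → lookup p (trueAt p i) ≡ true
lookup-trueAt (true ∷ p) F.zero = refl
lookup-trueAt (true ∷ p) (F.suc i) = lookup-trueAt p i
lookup-trueAt (false ∷ p) i = lookup-trueAt p i

lookup-falseAt : ∀ {k} (p : Vec Bool k) i → lookup p (falseAt p i) ≡ false
lookup-falseAt (false ∷ p) F.zero = refl
lookup-falseAt (false ∷ p) (F.suc i) = lookup-falseAt p i
lookup-falseAt (true ∷ p) i = lookup-falseAt p i

locate-true : ∀ {k} (p : Vec Bool k) {a i} → locate p a ≡ inj₁ i → lookup p a ≡ true
locate-true p {a} {i} e = trans (cong (lookup p) (sym (trueAt-locate p e))) (lookup-trueAt p i)

locate-false : ∀ {k} (p : Vec Bool k) {a i} → locate p a ≡ inj₂ i → lookup p a ≡ false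
locate-false p {a} {i} e = trans (cong (lookup p) (sym (falseAt-locate p e))) (lookup-falseAt p i)

trueAt-injective : ∀ {k} (p : Vec Bool k) {i j} → trueAt p i ≡ trueAt p j → i ≡ j
trueAt-injective p {i} {j} e = inj₁-injective (trans (sym (locate-trueAt p i)) (trans (cong (locate p) e) (locate-trueAt p j)))

falseAt-injective : ∀ {k} (p : Vec Bool k) {i j} → falseAt p i ≡ falseAt p j → i ≡ j
falseAt-injective p {i} {j} e = inj₂-injective (trans (sym (locate-falseAt p i)) (trans (cong (locate p) e) (locate-falseAt p j)))

-- Removing the top level

module Levels (s : ℕ) where

  Level : Set
  Level = Fin (suc (suc s))

  IsTop : Level → Set
  IsTop x = toℕ x ≡ suc s

  isTop? : ∀ x → Dec (IsTop x)
  isTop? x = toℕ x ℕ.≟ suc s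

  top : Level
  top = F.fromℕ (suc s)

  top-isTop : IsTop top
  top-isTop = Fin.toℕ-fromℕ (suc s)

  isTop-unique : ∀ {x y : Level} → IsTop x → IsTop y → x ≡ y
  isTop-unique x-top y-top = Fin.toℕ-injective (trans x-top (sym y-top))

  isTop⇒≢zero : ∀ {x : Level} → IsTop x → x ≢ F.zero
  isTop⇒≢zero x-top refl = ℕ.0≢1+n x-top

  ¬isTop⇒<top : ∀ {x : Level} → ¬ IsTop x → toℕ x < suc s
  ¬isTop⇒<top {x} = ℕ.≤∧≢⇒< (Fin.toℕ≤pred[n] x)

  isTop⇒≮ : ∀ {x y : Level} → IsTop x → ¬ (toℕ x < toℕ y)
  isTop⇒≮ {x} {y} x-top x<y = ℕ.<-irrefl refl (ℕ.<-≤-trans (subst (_< toℕ y) x-top x<y) (Fin.toℕ≤pred[n] y))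

  <⇒¬isTop : ∀ {x : Level} → toℕ x < suc s → ¬ IsTop x
  <⇒¬isTop x<top x-top = ℕ.<-irrefl x-top x<top

  inject₁-¬isTop : ∀ (y : Fin (suc s)) → ¬ IsTop (F.inject₁ y)
  inject₁-¬isTop y = <⇒¬isTop (subst (_< suc s) (sym (Fin.toℕ-inject₁ y)) (Fin.toℕ<n y))

  lower : Level → Fin (suc s)
  lower x with isTop? x
  ... | yes _ = F.zero
  ... | no x≢top = F.lower₁ x (x≢top ∘ sym)

  lower-isTop : ∀ {x} → IsTop x → lower x ≡ F.zero
  lower-isTop {x} x-top with isTop? x
  ... | yes _ = refl
  ... | no x≢top = ⊥-elim (x≢top x-top)

  toℕ-lower : ∀ {x} → ¬ IsTop x → toℕ (lower x) ≡ toℕ x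
  toℕ-lower {x} x≢top with isTop? x
  ... | yes x-top = ⊥-elim (x≢top x-top)
  ... | no _ = Fin.toℕ-lower₁ x _

  lower-inject₁ : ∀ y → lower (F.inject₁ y) ≡ y
  lower-inject₁ y = Fin.toℕ-injective (trans (toℕ-lower (inject₁-¬isTop y)) (Fin.toℕ-inject₁ y))

  inject₁-lower : ∀ {x} → ¬ IsTop x → F.inject₁ (lower x) ≡ x
  inject₁-lower x≢top = Fin.toℕ-injective (trans (Fin.toℕ-inject₁ _) (toℕ-lower x≢top))

module LevelSplit (d : ℕ) .{{_ : NonZero d}} (s : ℕ) where
  open Levels s
  open ZMod d
  open Coloured d

  dropTopη : Level → Fin d → Fin d
  dropTopη x e with isTop? x
  ... | yes _ = 0ₘ
  ... | no _ = e

  dropTopη-isTop : ∀ {x} e → IsTop x → toℕ (dropTopη x e) ≡ 0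
  dropTopη-isTop {x} e x-top with isTop? x
  ... | yes _ = toℕ-0ₘ
  ... | no x≢top = ⊥-elim (x≢top x-top)

  dropTopη-¬isTop : ∀ {x} e → ¬ IsTop x → dropTopη x e ≡ e
  dropTopη-¬isTop {x} e x≢top with isTop? x
  ... | yes x-top = ⊥-elim (x≢top x-top)
  ... | no _ = refl

  -- The colour of a vertex joined to a root of colour t by an edge with data (x , e).
  colour : Fin d → Level → Fin d → Fin d
  colour t x e with isTop? x
  ... | yes _ = t +ₘ e
  ... | no _ = t

  colour-isTop : ∀ t {x} e → IsTop x → colour t x e ≡ t +ₘ e
  colour-isTop t {x} e x-top with isTop? x
  ... | yes _ = refl
  ... | no x≢top = ⊥-elim (x≢top x-top)

  colour-¬isTop : ∀ t {x} e → ¬ IsTop x → colour t x e ≡ t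
  colour-¬isTop t {x} e x≢top with isTop? x
  ... | yes x-top = ⊥-elim (x≢top x-top)
  ... | no _ = refl

  liftξ : Fin d → Fin d → Fin (suc s) → Level
  liftξ ca cb x with ca Fin.≟ cb
  ... | yes _ = F.inject₁ x
  ... | no _ = top

  liftξ-same : ∀ {ca cb} x → ca ≡ cb → liftξ ca cb x ≡ F.inject₁ x
  liftξ-same {ca} {cb} x ca≡cb with ca Fin.≟ cb
  ... | yes _ = refl
  ... | no ca≢cb = ⊥-elim (ca≢cb ca≡cb)

  liftξ-different : ∀ {ca cb} x → ca ≢ cb → liftξ ca cb x ≡ top
  liftξ-different {ca} {cb} x ca≢cb with ca Fin.≟ cb
  ... | yes ca≡cb = ⊥-elim (ca≢cb ca≡cb)
  ... | no _ = refl

  liftη : Fin d → Fin d → Fin d → Fin d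
  liftη ca cb e with ca Fin.≟ cb
  ... | yes _ = e
  ... | no _ = cb -ₘ ca

  liftη-same : ∀ {ca cb} e → ca ≡ cb → liftη ca cb e ≡ e
  liftη-same {ca} {cb} e ca≡cb with ca Fin.≟ cb
  ... | yes _ = refl
  ... | no ca≢cb = ⊥-elim (ca≢cb ca≡cb)

  liftη-different : ∀ {ca cb} e → ca ≢ cb → liftη ca cb e ≡ cb -ₘ ca
  liftη-different {ca} {cb} e ca≢cb with ca Fin.≟ cb
  ... | yes ca≡cb = ⊥-elim (ca≢cb ca≡cb)
  ... | no _ = refl

  module _ {k : ℕ} where

    split : Fin d × Labelling (suc s) (suc k) → (Fin (suc k) → Fin d) × Labelling s (suc k)
    split (t , (ξ , η)) =
      (λ v → colour t (ξ F.zero v) (η F.zero v)) , ((λ a b → lower (ξ a b)) , (λ a b → dropTopη (ξ a b) (η a b)))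

    merge : (Fin (suc k) → Fin d) × Labelling s (suc k) → Fin d × Labelling (suc s) (suc k)
    merge (c , (ξ , η)) =
      c F.zero , ((λ a b → liftξ (c a) (c b) (ξ a b)) , (λ a b → liftη (c a) (c b) (η a b)))

  module Proper {n : ℕ} (ξ : XiFun (suc s) n) (η : EtaFun d n) (proper : IsCompleteProper (suc s) d n (ξ , η)) where

    ξ-sym : ∀ {a b} → a ≢ b → ξ a b ≡ ξ b a
    ξ-sym {a} {b} = proj₁ (proj₁ proper a b)

    η-inverse : ∀ {a b} → a ≢ b → (toℕ (η a b) + toℕ (η b a)) % d ≡ 0
    η-inverse {a} {b} = proj₁ (proj₂ (proj₁ proper a b))

    η-nonzero : ∀ {a b} → a ≢ b → ξ a b ≢ F.zero → toℕ (η a b) ≢ 0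
    η-nonzero {a} {b} = proj₁ (proj₂ (proj₂ (proj₂ (proj₁ proper a b))))

    diagonal-¬isTop : ∀ a → ¬ IsTop (ξ a a)
    diagonal-¬isTop a a-top = isTop⇒≢zero a-top (proj₁ (proj₂ (proj₂ (proj₂ (proj₂ (proj₁ proper a a))))) refl)

    isTop-sym : ∀ {a b} → a ≢ b → IsTop (ξ a b) → IsTop (ξ b a)
    isTop-sym a≢b = subst IsTop (ξ-sym a≢b)

    η-antisym : ∀ {a b} t → a ≢ b → η b a ≡ t -ₘ (t +ₘ η a b)
    η-antisym {a} {b} t a≢b = Fin.toℕ-injective
      (inverse-unique _ _ (toℕ (η a b)) (Fin.toℕ<n _) (Fin.toℕ<n _) (η-inverse (a≢b ∘ sym)) ([t-[t+e]]+e≡0 t (η a b)))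

    module _ {a b c : Fin n} (abc : Distinct3 a b c) where
      private
        a≢b = proj₁ abc
        a≢c = proj₁ (proj₂ abc)
        b≢c = proj₂ (proj₂ abc)
        rules = proj₂ proper a b c abc
        rule₁ = proj₁ rules
        rule₂ = proj₁ (proj₂ rules)
        rule₃ = proj₁ (proj₂ (proj₂ rules))
        rule₄ = proj₂ (proj₂ (proj₂ rules))
        rule₂-reversed = proj₁ (proj₂ (proj₂ proper c b a ((b≢c ∘ sym) , (a≢c ∘ sym) , (a≢b ∘ sym))))

        rule₄-¬isTop : ξ a b ≢ F.zero → ξ a b ≡ ξ b c → toℕ (η a b) + toℕ (η b c) ≡ d → ¬ IsTop (ξ a c)
        rule₄-¬isTop ab≢0 ab≡bc sum≡d =
          <⇒¬isTop (ℕ.<-≤-trans (rule₄ ab≢0 ab≡bc sum≡d) (Fin.toℕ≤pred[n] (ξ a b)))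

      below-then-top : ¬ IsTop (ξ a b) → IsTop (ξ b c) → ξ a c ≡ ξ b c × η a c ≡ η b c
      below-then-top ab≢top bc-top = rule₂ (subst (toℕ (ξ a b) <_) (sym bc-top) (¬isTop⇒<top ab≢top))

      top-top-cancel : IsTop (ξ a b) → IsTop (ξ b c) → toℕ (η a b) + toℕ (η b c) ≡ d → ¬ IsTop (ξ a c)
      top-top-cancel ab-top bc-top = rule₄-¬isTop (isTop⇒≢zero ab-top) (isTop-unique ab-top bc-top)

      top-top-add : IsTop (ξ a b) → IsTop (ξ b c) → toℕ (η a b) + toℕ (η b c) ≢ d →
                    IsTop (ξ a c) × toℕ (η a c) ≡ (toℕ (η a b) + toℕ (η b c)) % d
      top-top-add ab-top bc-top sum≢d =
        let (ac≡ab , ηac≡sum) = rule₃ (isTop⇒≢zero ab-top) (isTop-unique ab-top bc-top) sum≢d in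
        subst IsTop (sym ac≡ab) ab-top , ηac≡sum

      below-top-trans : ¬ IsTop (ξ a b) → ¬ IsTop (ξ b c) → ¬ IsTop (ξ a c)
      below-top-trans ab≢top bc≢top with ℕ.<-cmp (toℕ (ξ a b)) (toℕ (ξ b c))
      ... | tri< ab<bc _ _ = subst (¬_ ∘ IsTop) (sym (proj₁ (rule₂ ab<bc))) bc≢top
      ... | tri> _ _ bc<ab = subst (¬_ ∘ IsTop) (sym ac≡ab) ab≢top
        where
        ca≡ba = proj₁ (rule₂-reversed (subst₂ _<_ (cong toℕ (ξ-sym b≢c)) (cong toℕ (ξ-sym a≢b)) bc<ab))
        ac≡ab = trans (ξ-sym a≢c) (trans ca≡ba (sym (ξ-sym a≢b)))
      ... | tri≈ _ ab≈bc _ with ξ a b Fin.≟ F.zero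
      ...   | yes ab≡0 = λ ac-top → isTop⇒≢zero ac-top (rule₁ ab≡0 (trans (sym (Fin.toℕ-injective ab≈bc)) ab≡0))
      ...   | no ab≢0 with toℕ (η a b) + toℕ (η b c) ℕ.≟ d
      ...     | no sum≢d = subst (¬_ ∘ IsTop) (sym (proj₁ (rule₃ ab≢0 (Fin.toℕ-injective ab≈bc) sum≢d))) ab≢top
      ...     | yes sum≡d = rule₄-¬isTop ab≢0 (Fin.toℕ-injective ab≈bc) sum≡d

  module SplitCorrect {k : ℕ} (t : Fin d) (ξ : XiFun (suc s) (suc k)) (η : EtaFun d (suc k))
                      (proper : IsCompleteProper (suc s) d (suc k) (ξ , η)) where
    open Proper ξ η proper

    root : Fin (suc k)
    root = F.zero

    col : Fin (suc k) → Fin d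
    col = proj₁ (split (t , (ξ , η)))

    col-root : col root ≡ t
    col-root = colour-¬isTop t _ (diagonal-¬isTop root)

    col-isTop : ∀ {v} → IsTop (ξ root v) → col v ≡ t +ₘ η root v
    col-isTop {v} = colour-isTop t (η root v)

    col-¬isTop : ∀ {v} → ¬ IsTop (ξ root v) → col v ≡ t
    col-¬isTop {v} = colour-¬isTop t (η root v)

    col-isTop-≢ : ∀ {v} → root ≢ v → IsTop (ξ root v) → col v ≢ t
    col-isTop-≢ {v} root≢v v-top e =
      η-nonzero root≢v (isTop⇒≢zero v-top) (t+e≡t⇒e≡0 t (η root v) (trans (sym (col-isTop v-top)) e))

    data Classified (a b : Fin (suc k)) : Set where
      same      : ¬ IsTop (ξ a b) → col a ≡ col b → Classified a b
      different : IsTop (ξ a b) → col a ≢ col b → η a b ≡ col b -ₘ col a → Classified a b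

    classify-from-root : ∀ b → root ≢ b → Classified root b
    classify-from-root b root≢b with isTop? (ξ root b)
    ... | yes b-top = different b-top (λ e → col-isTop-≢ root≢b b-top (trans (sym e) col-root))
                        (trans (sym ([t+e]-t≡e t (η root b))) (cong₂ _-ₘ_ (sym (col-isTop b-top)) (sym col-root)))
    ... | no b≢top = same b≢top (trans col-root (sym (col-¬isTop b≢top)))

    classify-to-root : ∀ a → a ≢ root → Classified a root
    classify-to-root a a≢root with isTop? (ξ root a)
    ... | yes a-top = different (isTop-sym (a≢root ∘ sym) a-top)
                        (λ e → col-isTop-≢ (a≢root ∘ sym) a-top (trans e col-root))
                        (trans (η-antisym t (a≢root ∘ sym)) (cong₂ _-ₘ_ (sym col-root) (sym (col-isTop a-top))))
    ... | no a≢top = same (a≢top ∘ isTop-sym a≢root) (trans (col-¬isTop a≢top) (sym col-root))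

    classify-off-root : ∀ a b → a ≢ b → a ≢ root → b ≢ root → Classified a b
    classify-off-root a b a≢b a≢root b≢root with isTop? (ξ root a) | isTop? (ξ root b)
    ... | no a≢top | no b≢top =
      same (below-top-trans aob (a≢top ∘ isTop-sym a≢root) b≢top)
           (trans (col-¬isTop a≢top) (sym (col-¬isTop b≢top)))
      where aob = a≢root , a≢b , (b≢root ∘ sym)
    ... | no a≢top | yes b-top =
      different (subst IsTop (sym ξab≡) b-top)
        (λ e → col-isTop-≢ (b≢root ∘ sym) b-top (trans (sym e) (col-¬isTop a≢top)))
        (trans ηab≡ (trans (sym ([t+e]-t≡e t (η root b)))
          (cong₂ _-ₘ_ (sym (col-isTop b-top)) (sym (col-¬isTop a≢top)))))
      where
      aob = a≢root , a≢b , (b≢root ∘ sym)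
      ξab≡ = proj₁ (below-then-top aob (a≢top ∘ isTop-sym a≢root) b-top)
      ηab≡ = proj₂ (below-then-top aob (a≢top ∘ isTop-sym a≢root) b-top)
    ... | yes a-top | no b≢top =
      different (isTop-sym (a≢b ∘ sym) (subst IsTop (sym ξba≡) a-top))
        (λ e → col-isTop-≢ (a≢root ∘ sym) a-top (trans e (col-¬isTop b≢top)))
        (trans (η-antisym t (a≢b ∘ sym)) (trans (cong (λ z → t -ₘ (t +ₘ z)) ηba≡)
          (cong₂ _-ₘ_ (sym (col-¬isTop b≢top)) (sym (col-isTop a-top)))))
      where
      boa = b≢root , (a≢b ∘ sym) , (a≢root ∘ sym)
      ξba≡ = proj₁ (below-then-top boa (b≢top ∘ isTop-sym b≢root) a-top)
      ηba≡ = proj₂ (below-then-top boa (b≢top ∘ isTop-sym b≢root) a-top)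
    ... | yes a-top | yes b-top with toℕ (η a root) + toℕ (η root b) ℕ.≟ d
    ...   | yes sum≡d = same (top-top-cancel aob ao-top b-top sum≡d)
                          (trans (col-isTop a-top) (trans (cong (t +ₘ_) ηoa≡ηob) (sym (col-isTop b-top))))
      where
      aob = a≢root , a≢b , (b≢root ∘ sym)
      ao-top = isTop-sym (a≢root ∘ sym) a-top
      ηoa≡ηob : η root a ≡ η root b
      ηoa≡ηob = Fin.toℕ-injective (inverse-unique _ _ (toℕ (η a root)) (Fin.toℕ<n _) (Fin.toℕ<n _)
        (η-inverse (a≢root ∘ sym))
        (trans (cong (_% d) (trans (ℕ.+-comm (toℕ (η root b)) _) sum≡d)) (n%n≡0 d)))
    ...   | no sum≢d = different (proj₁ added) colours-differ
                         (Fin.toℕ-injective (ηab≡difference))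
      where
      aob = a≢root , a≢b , (b≢root ∘ sym)
      ao-top = isTop-sym (a≢root ∘ sym) a-top
      added = top-top-add aob ao-top b-top sum≢d
      colours-differ : col a ≢ col b
      colours-differ e = sum≢d (subst (λ z → toℕ (η a root) + toℕ z ≡ d)
        (+ₘ-cancelˡ t _ _ (trans (sym (col-isTop a-top)) (trans e (col-isTop b-top))))
        (x≢0∧[x+y]%d≡0⇒x+y≡d (η a root) (η root a)
          (η-nonzero a≢root (isTop⇒≢zero ao-top)) (η-inverse a≢root)))
      ηab≡difference : toℕ (η a b) ≡ toℕ (col b -ₘ col a)
      ηab≡difference = trans (proj₂ added)
        (trans (cong₂ (λ x y → (toℕ x + toℕ y) % d) (η-antisym t (a≢root ∘ sym)) (sym ([t+e]-t≡e t (η root b))))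
          (trans (sym (-ₘ-telescope (t +ₘ η root a) t (t +ₘ η root b)))
            (cong toℕ (cong₂ _-ₘ_ (sym (col-isTop b-top)) (sym (col-isTop a-top))))))

    classify : ∀ a b → Classified a b
    classify F.zero F.zero = same (diagonal-¬isTop root) refl
    classify F.zero (F.suc b) = classify-from-root (F.suc b) (λ ())
    classify (F.suc a) F.zero = classify-to-root (F.suc a) (λ ())
    classify (F.suc a) (F.suc b) with F.suc a Fin.≟ F.suc b
    ... | yes refl = same (diagonal-¬isTop (F.suc a)) refl
    ... | no a≢b = classify-off-root (F.suc a) (F.suc b) a≢b (λ ()) (λ ())

    same-colour⇒¬isTop : ∀ a b → col a ≡ col b → ¬ IsTop (ξ a b)
    same-colour⇒¬isTop a b e with classify a b
    ... | same ab≢top _ = ab≢top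
    ... | different _ ca≢cb _ = ⊥-elim (ca≢cb e)

    different-colour⇒isTop : ∀ a b → col a ≢ col b → IsTop (ξ a b)
    different-colour⇒isTop a b ca≢cb with classify a b
    ... | same _ e = ⊥-elim (ca≢cb e)
    ... | different ab-top _ _ = ab-top

    different-colour⇒η : ∀ a b → col a ≢ col b → η a b ≡ col b -ₘ col a
    different-colour⇒η a b ca≢cb with classify a b
    ... | same _ e = ⊥-elim (ca≢cb e)
    ... | different _ _ ηab≡ = ηab≡

    split-isColouredProper : IsColouredProper s d (suc k) (split (t , (ξ , η)))
    split-isColouredProper =
      (λ a b e → PairOK-transport d ξ η ξ' η' a b a b (λ z → z) (λ z → z)
                   (ξ≈ a b e) (ξ≈ b a (sym e)) (η≈ a b e) (η≈ b a (sym e)) (proj₁ proper a b)) ,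
      (λ a b c e₁ e₂ → TripleOK-transport d ξ η ξ' η' a b c a b c (λ z → z)
                   (ξ≈ a b e₁) (ξ≈ b c e₂) (ξ≈ a c (trans e₁ e₂))
                   (η≈ a b e₁) (η≈ b c e₂) (η≈ a c (trans e₁ e₂))
                   (proj₂ proper a b c)) ,
      (λ a b ca≢cb → lower-isTop (different-colour⇒isTop a b ca≢cb) ,
                     dropTopη-isTop (η a b) (different-colour⇒isTop a b ca≢cb))
      where
      ξ' = proj₁ (proj₂ (split (t , (ξ , η))))
      η' = proj₂ (proj₂ (split (t , (ξ , η))))
      ξ≈ : ∀ a b → col a ≡ col b → toℕ (ξ a b) ≡ toℕ (ξ' a b)
      ξ≈ a b e = sym (toℕ-lower (same-colour⇒¬isTop a b e))
      η≈ : ∀ a b → col a ≡ col b → η a b ≡ η' a b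
      η≈ a b e = sym (dropTopη-¬isTop (η a b) (same-colour⇒¬isTop a b e))

    merge-split : FiniteSetoid._≈_ (finiteFin d ×ᶠ labellings (suc s) (suc k))
                    (merge (split (t , (ξ , η)))) (t , (ξ , η))
    merge-split = col-root , ((λ a b → ξ≡ a b (col a Fin.≟ col b)) , (λ a b → η≡ a b (col a Fin.≟ col b)))
      where
      ξ≡ : ∀ a b → Dec (col a ≡ col b) → liftξ (col a) (col b) (lower (ξ a b)) ≡ ξ a b
      ξ≡ a b (yes e) = trans (liftξ-same _ e) (inject₁-lower (same-colour⇒¬isTop a b e))
      ξ≡ a b (no ca≢cb) = trans (liftξ-different _ ca≢cb) (isTop-unique top-isTop (different-colour⇒isTop a b ca≢cb))
      η≡ : ∀ a b → Dec (col a ≡ col b) → liftη (col a) (col b) (dropTopη (ξ a b) (η a b)) ≡ η a b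
      η≡ a b (yes e) = trans (liftη-same _ e) (dropTopη-¬isTop (η a b) (same-colour⇒¬isTop a b e))
      η≡ a b (no ca≢cb) = trans (liftη-different _ ca≢cb) (sym (different-colour⇒η a b ca≢cb))

  module MergeCorrect {k : ℕ} (c : Fin (suc k) → Fin d) (ξ : XiFun s (suc k)) (η : EtaFun d (suc k))
                      (coloured : IsColouredProper s d (suc k) (c , (ξ , η))) where
    private
      pairs = proj₁ coloured
      triples = proj₁ (proj₂ coloured)
      across = proj₂ (proj₂ coloured)

    ξ' : XiFun (suc s) (suc k)
    ξ' = proj₁ (proj₂ (merge (c , (ξ , η))))

    η' : EtaFun d (suc k)
    η' = proj₂ (proj₂ (merge (c , (ξ , η))))

    ξ≈ : ∀ a b → c a ≡ c b → toℕ (ξ a b) ≡ toℕ (ξ' a b)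
    ξ≈ a b e = sym (trans (cong toℕ (liftξ-same _ e)) (Fin.toℕ-inject₁ _))

    η≈ : ∀ a b → c a ≡ c b → η a b ≡ η' a b
    η≈ a b e = sym (liftη-same _ e)

    ξ'-isTop : ∀ a b → c a ≢ c b → IsTop (ξ' a b)
    ξ'-isTop a b ca≢cb = subst IsTop (sym (liftξ-different _ ca≢cb)) top-isTop

    ξ'-¬isTop : ∀ a b → c a ≡ c b → ¬ IsTop (ξ' a b)
    ξ'-¬isTop a b e = subst (¬_ ∘ IsTop) (sym (liftξ-same _ e)) (inject₁-¬isTop _)

    toℕ-η' : ∀ a b → c a ≢ c b → toℕ (η' a b) ≡ toℕ (c b -ₘ c a)
    toℕ-η' a b ca≢cb = cong toℕ (liftη-different _ ca≢cb)

    isTop-≢ : ∀ {x y : Level} → IsTop x → ¬ IsTop y → x ≢ y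
    isTop-≢ x-top y≢top e = y≢top (subst IsTop e x-top)

    pairOK : ∀ a b → Dec (c a ≡ c b) → PairOK (suc s) d (suc k) ξ' η' a b
    pairOK a b (yes e) = PairOK-transport d ξ η ξ' η' a b a b (λ z → z) (λ z → z)
                           (ξ≈ a b e) (ξ≈ b a (sym e)) (η≈ a b e) (η≈ b a (sym e)) (pairs a b e)
    pairOK a b (no ca≢cb) =
      (λ _ → isTop-unique (ξ'-isTop a b ca≢cb) (ξ'-isTop b a cb≢ca)) ,
      (λ _ → subst (λ z → z % d ≡ 0) (sym (cong₂ _+_ (toℕ-η' a b ca≢cb) (toℕ-η' b a cb≢ca)))
                   ([b-a]+[a-b]≡0 (c a) (c b))) ,
      (λ _ ξ≡0 → ⊥-elim (isTop⇒≢zero (ξ'-isTop a b ca≢cb) ξ≡0)) ,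
      (λ _ _ η≡0 → ca≢cb (sym (u-t≡0⇒u≡t (c b) (c a) (trans (sym (toℕ-η' a b ca≢cb)) η≡0)))) ,
      (λ a≡b → ⊥-elim (ca≢cb (cong c a≡b))) ,
      (λ a≡b → ⊥-elim (ca≢cb (cong c a≡b)))
      where
      cb≢ca = ca≢cb ∘ sym

    tripleOK : ∀ a b e → Dec (c a ≡ c b) → Dec (c b ≡ c e) → Dec (c a ≡ c e) →
               TripleOK (suc s) d (suc k) ξ' η' a b e
    tripleOK a b e (yes ab) (yes be) _ =
      TripleOK-transport d ξ η ξ' η' a b e a b e (λ z → z)
        (ξ≈ a b ab) (ξ≈ b e be) (ξ≈ a e (trans ab be)) (η≈ a b ab) (η≈ b e be) (η≈ a e (trans ab be))
        (triples a b e ab be)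
    tripleOK a b e (yes ab) (no b≢e) _ _ =
      (λ _ be≡0 → ⊥-elim (isTop⇒≢zero (ξ'-isTop b e b≢e) be≡0)) ,
      (λ _ → isTop-unique (ξ'-isTop a e a≢e) (ξ'-isTop b e b≢e) ,
             Fin.toℕ-injective (trans (toℕ-η' a e a≢e)
               (trans (cong (λ z → toℕ (c e -ₘ z)) ab) (sym (toℕ-η' b e b≢e))))) ,
      (λ _ ab≡be _ → ⊥-elim (isTop-≢ (ξ'-isTop b e b≢e) (ξ'-¬isTop a b ab) (sym ab≡be))) ,
      (λ _ ab≡be _ → ⊥-elim (isTop-≢ (ξ'-isTop b e b≢e) (ξ'-¬isTop a b ab) (sym ab≡be)))
      where
      a≢e = λ ae → b≢e (trans (sym ab) ae)
    tripleOK a b e (no a≢b) (yes be) _ _ =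
      (λ ab≡0 _ → ⊥-elim (isTop⇒≢zero (ξ'-isTop a b a≢b) ab≡0)) ,
      (λ ab<be → ⊥-elim (isTop⇒≮ (ξ'-isTop a b a≢b) ab<be)) ,
      (λ _ ab≡be _ → ⊥-elim (isTop-≢ (ξ'-isTop a b a≢b) (ξ'-¬isTop b e be) ab≡be)) ,
      (λ _ ab≡be _ → ⊥-elim (isTop-≢ (ξ'-isTop a b a≢b) (ξ'-¬isTop b e be) ab≡be))
    tripleOK a b e (no a≢b) (no b≢e) (yes ae) _ =
      (λ ab≡0 _ → ⊥-elim (isTop⇒≢zero (ξ'-isTop a b a≢b) ab≡0)) ,
      (λ ab<be → ⊥-elim (isTop⇒≮ (ξ'-isTop a b a≢b) ab<be)) ,
      (λ _ _ sum≢d → ⊥-elim (sum≢d sum≡d)) ,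
      (λ _ _ _ → subst (toℕ (ξ' a e) <_) (sym (ξ'-isTop a b a≢b)) (¬isTop⇒<top (ξ'-¬isTop a e ae)))
      where
      -- c e = c a, so the two top edges a → b → e carry mutually inverse nonzero η.
      sum≡d : toℕ (η' a b) + toℕ (η' b e) ≡ d
      sum≡d = trans (cong₂ _+_ (toℕ-η' a b a≢b) (trans (toℕ-η' b e b≢e) (cong (λ z → toℕ (z -ₘ c b)) (sym ae))))
                (x≢0∧[x+y]%d≡0⇒x+y≡d (c b -ₘ c a) (c a -ₘ c b)
                  (λ z → a≢b (sym (u-t≡0⇒u≡t (c b) (c a) z)))
                  ([b-a]+[a-b]≡0 (c a) (c b)))
    tripleOK a b e (no a≢b) (no b≢e) (no a≢e) _ =
      (λ ab≡0 _ → ⊥-elim (isTop⇒≢zero (ξ'-isTop a b a≢b) ab≡0)) ,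
      (λ ab<be → ⊥-elim (isTop⇒≮ (ξ'-isTop a b a≢b) ab<be)) ,
      (λ _ _ _ → isTop-unique (ξ'-isTop a e a≢e) (ξ'-isTop a b a≢b) ,
                 trans (toℕ-η' a e a≢e) (trans (-ₘ-telescope (c a) (c b) (c e)) (cong (_% d) (sym sum≡)))) ,
      (λ _ _ sum≡d → ⊥-elim (a≢e (sym (u-t≡0⇒u≡t (c e) (c a)
        (trans (-ₘ-telescope (c a) (c b) (c e)) (trans (cong (_% d) (trans (sym sum≡) sum≡d)) (n%n≡0 d)))))))
      where
      sum≡ : toℕ (η' a b) + toℕ (η' b e) ≡ toℕ (c b -ₘ c a) + toℕ (c e -ₘ c b)
      sum≡ = cong₂ _+_ (toℕ-η' a b a≢b) (toℕ-η' b e b≢e)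

    merge-isCompleteProper : IsCompleteProper (suc s) d (suc k) (ξ' , η')
    merge-isCompleteProper =
      (λ a b → pairOK a b (c a Fin.≟ c b)) ,
      (λ a b e → tripleOK a b e (c a Fin.≟ c b) (c b Fin.≟ c e) (c a Fin.≟ c e))

    split-merge : FiniteSetoid._≈_ (colouredLabellings s d (suc k)) (split (merge (c , (ξ , η)))) (c , (ξ , η))
    split-merge =
      (λ v → colour≡ v (c F.zero Fin.≟ c v)) ,
      ((λ a b → ξ≡ a b (c a Fin.≟ c b)) , (λ a b → η≡ a b (c a Fin.≟ c b)))
      where
      colour≡ : ∀ v → Dec (c F.zero ≡ c v) → colour (c F.zero) (ξ' F.zero v) (η' F.zero v) ≡ c v
      colour≡ v (yes e) = trans (colour-¬isTop _ _ (ξ'-¬isTop F.zero v e)) e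
      colour≡ v (no c0≢cv) = trans (colour-isTop _ _ (ξ'-isTop F.zero v c0≢cv))
                                   (trans (cong (c F.zero +ₘ_) (liftη-different _ c0≢cv)) (t+[u-t]≡u (c F.zero) (c v)))
      ξ≡ : ∀ a b → Dec (c a ≡ c b) → lower (ξ' a b) ≡ ξ a b
      ξ≡ a b (yes e) = trans (cong lower (liftξ-same _ e)) (lower-inject₁ _)
      ξ≡ a b (no ca≢cb) = trans (lower-isTop (ξ'-isTop a b ca≢cb)) (sym (proj₁ (across a b ca≢cb)))
      η≡ : ∀ a b → Dec (c a ≡ c b) → dropTopη (ξ' a b) (η' a b) ≡ η a b
      η≡ a b (yes e) = trans (dropTopη-¬isTop _ (ξ'-¬isTop a b e)) (liftη-same _ e)
      η≡ a b (no ca≢cb) =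
        Fin.toℕ-injective (trans (dropTopη-isTop _ (ξ'-isTop a b ca≢cb)) (sym (proj₂ (across a b ca≢cb))))

  module _ (k : ℕ) where
    private
      Rooted = finiteFin d ×ᶠ labellings (suc s) (suc k)
      Coloured = colouredLabellings s d (suc k)
      open FiniteSetoid Rooted using () renaming (_≈_ to _≈ᴿ_)
      open FiniteSetoid Coloured using () renaming (_≈_ to _≈ᶜ_)

    split-resp : ∀ {x x'} → x ≈ᴿ x' → split x ≈ᶜ split x'
    split-resp {t , (ξ , η)} {t' , (ξ' , η')} (refl , (eξ , eη)) =
      (λ v → cong₂ (colour t) (eξ F.zero v) (eη F.zero v)) ,
      ((λ a b → cong lower (eξ a b)) , (λ a b → cong₂ dropTopη (eξ a b) (eη a b)))

    merge-resp : ∀ {y y'} → y ≈ᶜ y' → merge y ≈ᴿ merge y'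
    merge-resp {c , (ξ , η)} {c' , (ξ' , η')} (ec , (eξ , eη)) =
      ec F.zero ,
      ((λ a b → trans (cong₂ (λ x y → liftξ x y (ξ a b)) (ec a) (ec b)) (cong (liftξ (c' a) (c' b)) (eξ a b))) ,
       (λ a b → trans (cong₂ (λ x y → liftη x y (η a b)) (ec a) (ec b)) (cong (liftη (c' a) (c' b)) (eη a b))))

    countColoured≡d*countProper : countColoured s d (suc k) ≡ d * countProper (suc s) (suc k)
    countColoured≡d*countProper = begin
      countColoured s d (suc k)
        ≡⟨ sym (count-bijection Rooted Coloured proper? (isColouredProper? s d (suc k))
                  (λ {(_ , G)} {(_ , G')} (_ , (eξ , eη)) → IsCompleteProper-resp d eξ eη)
                  (λ {y} {y'} → IsColouredProper-resp {x = y} {y'})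
                  split merge (λ {x} {x'} → split-resp {x} {x'}) (λ {y} {y'} → merge-resp {y} {y'})
                  (λ (t , (ξ , η)) proper → SplitCorrect.split-isColouredProper t ξ η proper)
                  (λ (t , (ξ , η)) proper → SplitCorrect.merge-split t ξ η proper)
                  (λ (c , (ξ , η)) coloured → MergeCorrect.merge-isCompleteProper c ξ η coloured)
                  (λ (c , (ξ , η)) coloured → MergeCorrect.split-merge c ξ η coloured)) ⟩
      count Rooted proper?
        ≡⟨ ∑-cong (FiniteSetoid.elements Rooted) (λ _ → sym (ℕ.*-identityˡ _)) ⟩
      ∑ (FiniteSetoid.elements Rooted) (λ x → 1 * indicator (proper? x))
        ≡⟨ ∑-cartesianProduct-* (allFin d) (FiniteSetoid.elements (labellings (suc s) (suc k)))
                                (λ _ → 1) (λ G → indicator (isCompleteProper? (suc s) d (suc k) G)) ⟩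
      ∑ (allFin d) (λ _ → 1) * countProper (suc s) (suc k)
        ≡⟨ cong (_* countProper (suc s) (suc k)) (∑-allFin-1 d) ⟩
      d * countProper (suc s) (suc k) ∎
      where
      open ≡-Reasoning
      proper? = λ (x : FiniteSetoid.Carrier Rooted) → isCompleteProper? (suc s) d (suc k) (proj₂ x)

-- Splitting off the first colour class

isZero : ∀ {n} → Fin (suc n) → Bool
isZero F.zero = true
isZero (F.suc _) = false

isZero-true : ∀ {n} {x : Fin (suc n)} → isZero x ≡ true → x ≡ F.zero
isZero-true {x = F.zero} _ = refl

unshift : ∀ {n} → Fin (suc (suc n)) → Fin (suc n)
unshift F.zero = F.zero
unshift (F.suc x) = x

suc-unshift : ∀ {n} {x : Fin (suc (suc n))} → isZero x ≡ false → F.suc (unshift x) ≡ x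
suc-unshift {x = F.suc x} _ = refl

unshift-injective : ∀ {n} {x y : Fin (suc (suc n))} → isZero x ≡ false → isZero y ≡ false →
                    unshift x ≡ unshift y → x ≡ y
unshift-injective {x = F.suc x} {F.suc y} _ _ e = cong F.suc e

module ColourSplit (d : ℕ) .{{_ : NonZero d}} (s j k : ℕ) (w : Fin k → Bool) where
  open Coloured d
  open ZMod d using (0ₘ; toℕ-0ₘ)

  private
    p : Vec Bool k
    p = tabulate w
    n₁ = countTrue p
    n₂ = countFalse p

  locate-inj₁⇒true : ∀ {a i} → locate p a ≡ inj₁ i → w a ≡ true
  locate-inj₁⇒true {a} e = trans (sym (lookup∘tabulate w a)) (locate-true p e)

  locate-inj₂⇒false : ∀ {a i} → locate p a ≡ inj₂ i → w a ≡ false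
  locate-inj₂⇒false {a} e = trans (sym (lookup∘tabulate w a)) (locate-false p e)

  combine : A → (Fin n₁ → Fin n₁ → A) → (Fin n₂ → Fin n₂ → A) →
            Fin n₁ ⊎ Fin n₂ → Fin n₁ ⊎ Fin n₂ → A
  combine z f g (inj₁ i) (inj₁ i') = f i i'
  combine z f g (inj₂ i) (inj₂ i') = g i i'
  combine z f g (inj₁ _) (inj₂ _) = z
  combine z f g (inj₂ _) (inj₁ _) = z

  glue : A → (Fin n₁ → Fin n₁ → A) → (Fin n₂ → Fin n₂ → A) → Fin k → Fin k → A
  glue z f g a b = combine z f g (locate p a) (locate p b)

  glue-resp : (z : A) {f f' : Fin n₁ → Fin n₁ → A} {g g' : Fin n₂ → Fin n₂ → A} →
    (∀ i i' → f i i' ≡ f' i i') → (∀ i i' → g i i' ≡ g' i i') → ∀ a b → glue z f g a b ≡ glue z f' g' a b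
  glue-resp z ef eg a b = combine-resp (locate p a) (locate p b)
    where
    combine-resp : ∀ u v → combine z _ _ u v ≡ combine z _ _ u v
    combine-resp (inj₁ i) (inj₁ i') = ef i i'
    combine-resp (inj₂ i) (inj₂ i') = eg i i'
    combine-resp (inj₁ _) (inj₂ _) = refl
    combine-resp (inj₂ _) (inj₁ _) = refl

  pasteColour : (Fin n₂ → Fin (suc j)) → Fin n₁ ⊎ Fin n₂ → Fin (suc (suc j))
  pasteColour c₂ (inj₁ _) = F.zero
  pasteColour c₂ (inj₂ i) = F.suc (c₂ i)

  Whole = colouredLabellings s (suc (suc j)) k
  Parts = labellings s n₁ ×ᶠ colouredLabellings s (suc j) n₂

  open FiniteSetoid Whole using () renaming (Carrier to W; _≈_ to _≈ᵂ_)
  open FiniteSetoid Parts using () renaming (Carrier to P; _≈_ to _≈ᴾ_)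

  cut : W → P
  cut (c , (ξ , η)) =
    (reindex (trueAt p) ξ , reindex (trueAt p) η) ,
    (unshift ∘ c ∘ falseAt p , (reindex (falseAt p) ξ , reindex (falseAt p) η))

  paste : P → W
  paste ((ξ₁ , η₁) , (c₂ , (ξ₂ , η₂))) =
    (pasteColour c₂ ∘ locate p) , (glue F.zero ξ₁ ξ₂ , glue 0ₘ η₁ η₂)

  ZeroClassIs : W → Set
  ZeroClassIs (c , _) = ∀ a → isZero (c a) ≡ w a

  GoodWhole : W → Set
  GoodWhole x = ZeroClassIs x × IsColouredProper s (suc (suc j)) k x

  goodWhole? : ∀ x → Dec (GoodWhole x)
  goodWhole? x = FiniteSetoid._≟_ (finiteFun k finiteBool) (isZero ∘ proj₁ x) w ×-dec isColouredProper? s (suc (suc j)) k x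

  GoodParts : P → Set
  GoodParts (G , y) = IsCompleteProper s d n₁ G × IsColouredProper s (suc j) n₂ y

  goodParts? : ∀ y → Dec (GoodParts y)
  goodParts? (G , y) = isCompleteProper? s d n₁ G ×-dec isColouredProper? s (suc j) n₂ y

  cut-good : ∀ x → GoodWhole x → GoodParts (cut x)
  cut-good (c , (ξ , η)) (zero-class , (pairs , triples , across)) = proper₁ , (pairs₂ , triples₂ , across₂)
    where
    c≡0 : ∀ i → c (trueAt p i) ≡ F.zero
    c≡0 i = isZero-true (trans (zero-class (trueAt p i)) (locate-inj₁⇒true (locate-trueAt p i)))
    c≢0 : ∀ i → isZero (c (falseAt p i)) ≡ false
    c≢0 i = trans (zero-class (falseAt p i)) (locate-inj₂⇒false (locate-falseAt p i))
    same₁ : ∀ i i' → c (trueAt p i) ≡ c (trueAt p i')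
    same₁ i i' = trans (c≡0 i) (sym (c≡0 i'))
    same₂ : ∀ {i i'} → unshift (c (falseAt p i)) ≡ unshift (c (falseAt p i')) → c (falseAt p i) ≡ c (falseAt p i')
    same₂ {i} {i'} = unshift-injective (c≢0 i) (c≢0 i')
    proper₁ : IsCompleteProper s d n₁ (reindex (trueAt p) ξ , reindex (trueAt p) η)
    proper₁ =
      (λ i i' → PairOK-reindex d (trueAt p) (trueAt-injective p) ξ η i i' (pairs _ _ (same₁ i i'))) ,
      (λ i i' i'' → TripleOK-reindex d (trueAt p) (trueAt-injective p) ξ η i i' i''
                      (triples _ _ _ (same₁ i i') (same₁ i' i'')))
    pairs₂ = λ i i' e → PairOK-reindex d (falseAt p) (falseAt-injective p) ξ η i i' (pairs _ _ (same₂ e))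
    triples₂ = λ i i' i'' e₁ e₂ → TripleOK-reindex d (falseAt p) (falseAt-injective p) ξ η i i' i''
                                    (triples _ _ _ (same₂ e₁) (same₂ e₂))
    across₂ = λ i i' c≢c' → across (falseAt p i) (falseAt p i') (c≢c' ∘ cong unshift)

  paste-cut : ∀ x → GoodWhole x → paste (cut x) ≈ᵂ x
  paste-cut (c , (ξ , η)) (zero-class , (_ , _ , across)) = colour≡ , (ξ≡ , η≡)
    where
    in-zero-class : ∀ {a i} → locate p a ≡ inj₁ i → isZero (c a) ≡ true
    in-zero-class e = trans (zero-class _) (locate-inj₁⇒true e)
    off-zero-class : ∀ {a i} → locate p a ≡ inj₂ i → isZero (c a) ≡ false
    off-zero-class e = trans (zero-class _) (locate-inj₂⇒false e)
    different : ∀ {a b i i'} → locate p a ≡ inj₁ i → locate p b ≡ inj₂ i' → c a ≢ c b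
    different ea eb ca≡cb with trans (sym (in-zero-class ea)) (trans (cong isZero ca≡cb) (off-zero-class eb))
    ... | ()
    colour≡ : ∀ a → pasteColour (unshift ∘ c ∘ falseAt p) (locate p a) ≡ c a
    colour≡ a with locate p a in ea
    ... | inj₁ i = sym (isZero-true (in-zero-class ea))
    ... | inj₂ i = trans (suc-unshift (off-zero-class (locate-falseAt p i))) (cong c (falseAt-locate p ea))
    ξ≡ : ∀ a b → glue F.zero (reindex (trueAt p) ξ) (reindex (falseAt p) ξ) a b ≡ ξ a b
    ξ≡ a b with locate p a in ea | locate p b in eb
    ... | inj₁ i | inj₁ i' = cong₂ ξ (trueAt-locate p ea) (trueAt-locate p eb)
    ... | inj₂ i | inj₂ i' = cong₂ ξ (falseAt-locate p ea) (falseAt-locate p eb)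
    ... | inj₁ i | inj₂ i' = sym (proj₁ (across a b (different ea eb)))
    ... | inj₂ i | inj₁ i' = sym (proj₁ (across a b (different eb ea ∘ sym)))
    η≡ : ∀ a b → glue 0ₘ (reindex (trueAt p) η) (reindex (falseAt p) η) a b ≡ η a b
    η≡ a b with locate p a in ea | locate p b in eb
    ... | inj₁ i | inj₁ i' = cong₂ η (trueAt-locate p ea) (trueAt-locate p eb)
    ... | inj₂ i | inj₂ i' = cong₂ η (falseAt-locate p ea) (falseAt-locate p eb)
    ... | inj₁ i | inj₂ i' = Fin.toℕ-injective (trans toℕ-0ₘ (sym (proj₂ (across a b (different ea eb)))))
    ... | inj₂ i | inj₁ i' = Fin.toℕ-injective (trans toℕ-0ₘ (sym (proj₂ (across a b (different eb ea ∘ sym)))))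

  paste-good : ∀ y → GoodParts y → GoodWhole (paste y)
  paste-good ((ξ₁ , η₁) , (c₂ , (ξ₂ , η₂))) ((pairs₁ , triples₁) , (pairs₂ , triples₂ , across₂)) =
    zero-class , (pairs , triples , across)
    where
    c = pasteColour c₂ ∘ locate p
    ξ = glue F.zero ξ₁ ξ₂
    η = glue 0ₘ η₁ η₂
    zero-class : ∀ a → isZero (c a) ≡ w a
    zero-class a with locate p a in e
    ... | inj₁ _ = sym (locate-inj₁⇒true e)
    ... | inj₂ _ = sym (locate-inj₂⇒false e)
    colour-at : ∀ {a u} → locate p a ≡ u → c a ≡ pasteColour c₂ u
    colour-at = cong (pasteColour c₂)
    zero≢suc : ∀ {x : Fin (suc j)} → F.zero ≢ F.suc x
    zero≢suc ()
    ξ≡ : ∀ {a b u v} → locate p a ≡ u → locate p b ≡ v → ξ a b ≡ combine F.zero ξ₁ ξ₂ u v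
    ξ≡ = cong₂ (combine F.zero ξ₁ ξ₂)
    η≡ : ∀ {a b u v} → locate p a ≡ u → locate p b ≡ v → η a b ≡ combine 0ₘ η₁ η₂ u v
    η≡ = cong₂ (combine 0ₘ η₁ η₂)
    ξ-at : ∀ {a b u v} → locate p a ≡ u → locate p b ≡ v → toℕ (combine F.zero ξ₁ ξ₂ u v) ≡ toℕ (ξ a b)
    ξ-at ea eb = cong toℕ (sym (ξ≡ ea eb))
    η-at : ∀ {a b u v} → locate p a ≡ u → locate p b ≡ v → combine 0ₘ η₁ η₂ u v ≡ η a b
    η-at ea eb = sym (η≡ ea eb)
    same₁ : ∀ {a b i i'} → locate p a ≡ inj₁ i → locate p b ≡ inj₁ i' →
            (i ≡ i' → a ≡ b) × (a ≡ b → i ≡ i')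
    same₁ ea eb = (λ i≡i' → trans (sym (trueAt-locate p ea)) (trans (cong (trueAt p) i≡i') (trueAt-locate p eb))) ,
                  (λ a≡b → Data.Sum.Properties.inj₁-injective (trans (sym ea) (trans (cong (locate p) a≡b) eb)))
    same₂ : ∀ {a b i i'} → locate p a ≡ inj₂ i → locate p b ≡ inj₂ i' →
            (i ≡ i' → a ≡ b) × (a ≡ b → i ≡ i')
    same₂ ea eb = (λ i≡i' → trans (sym (falseAt-locate p ea)) (trans (cong (falseAt p) i≡i') (falseAt-locate p eb))) ,
                  (λ a≡b → Data.Sum.Properties.inj₂-injective (trans (sym ea) (trans (cong (locate p) a≡b) eb)))
    c₂-same : ∀ {a b i i'} → locate p a ≡ inj₂ i → locate p b ≡ inj₂ i' → c a ≡ c b → c₂ i ≡ c₂ i'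
    c₂-same ea eb ca≡cb = Fin.suc-injective (trans (sym (colour-at ea)) (trans ca≡cb (colour-at eb)))
    pairs : ∀ a b → c a ≡ c b → PairOK s d k ξ η a b
    pairs a b ca≡cb = at (locate p a) (locate p b) refl refl
      where
      at : ∀ u v → locate p a ≡ u → locate p b ≡ v → PairOK s d k ξ η a b
      at (inj₁ i) (inj₁ i') ea eb =
        PairOK-transport d ξ₁ η₁ ξ η i i' a b (proj₁ (same₁ ea eb)) (proj₂ (same₁ ea eb))
          (ξ-at ea eb) (ξ-at eb ea) (η-at ea eb) (η-at eb ea) (pairs₁ i i')
      at (inj₂ i) (inj₂ i') ea eb =
        PairOK-transport d ξ₂ η₂ ξ η i i' a b (proj₁ (same₂ ea eb)) (proj₂ (same₂ ea eb))
          (ξ-at ea eb) (ξ-at eb ea) (η-at ea eb) (η-at eb ea) (pairs₂ i i' (c₂-same ea eb ca≡cb))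
      at (inj₁ _) (inj₂ _) ea eb = ⊥-elim (zero≢suc (trans (sym (colour-at ea)) (trans ca≡cb (colour-at eb))))
      at (inj₂ _) (inj₁ _) ea eb = ⊥-elim (zero≢suc (sym (trans (sym (colour-at ea)) (trans ca≡cb (colour-at eb)))))
    triples : ∀ a b e → c a ≡ c b → c b ≡ c e → TripleOK s d k ξ η a b e
    triples a b e ca≡cb cb≡ce = at (locate p a) (locate p b) (locate p e) refl refl refl
      where
      at : ∀ u v x → locate p a ≡ u → locate p b ≡ v → locate p e ≡ x → TripleOK s d k ξ η a b e
      at (inj₁ i) (inj₁ i') (inj₁ i'') ea eb ee =
        TripleOK-transport d ξ₁ η₁ ξ η i i' i'' a b e
          (λ (x , y , z) → x ∘ proj₁ (same₁ ea eb) , y ∘ proj₁ (same₁ ea ee) , z ∘ proj₁ (same₁ eb ee))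
          (ξ-at ea eb) (ξ-at eb ee) (ξ-at ea ee) (η-at ea eb) (η-at eb ee) (η-at ea ee) (triples₁ i i' i'')
      at (inj₂ i) (inj₂ i') (inj₂ i'') ea eb ee =
        TripleOK-transport d ξ₂ η₂ ξ η i i' i'' a b e
          (λ (x , y , z) → x ∘ proj₁ (same₂ ea eb) , y ∘ proj₁ (same₂ ea ee) , z ∘ proj₁ (same₂ eb ee))
          (ξ-at ea eb) (ξ-at eb ee) (ξ-at ea ee) (η-at ea eb) (η-at eb ee) (η-at ea ee)
          (triples₂ i i' i'' (c₂-same ea eb ca≡cb) (c₂-same eb ee cb≡ce))
      at (inj₁ _) (inj₁ _) (inj₂ _) ea eb ee =
        ⊥-elim (zero≢suc (trans (sym (colour-at eb)) (trans cb≡ce (colour-at ee))))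
      at (inj₁ _) (inj₂ _) _ ea eb ee = ⊥-elim (zero≢suc (trans (sym (colour-at ea)) (trans ca≡cb (colour-at eb))))
      at (inj₂ _) (inj₁ _) _ ea eb ee =
        ⊥-elim (zero≢suc (sym (trans (sym (colour-at ea)) (trans ca≡cb (colour-at eb)))))
      at (inj₂ _) (inj₂ _) (inj₁ _) ea eb ee =
        ⊥-elim (zero≢suc (sym (trans (sym (colour-at eb)) (trans cb≡ce (colour-at ee)))))
    across : ∀ a b → c a ≢ c b → (ξ a b ≡ F.zero) × (toℕ (η a b) ≡ 0)
    across a b ca≢cb = at (locate p a) (locate p b) refl refl
      where
      at : ∀ u v → locate p a ≡ u → locate p b ≡ v → (ξ a b ≡ F.zero) × (toℕ (η a b) ≡ 0)
      at (inj₁ _) (inj₁ _) ea eb = ⊥-elim (ca≢cb (trans (colour-at ea) (sym (colour-at eb))))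
      at (inj₂ i) (inj₂ i') ea eb =
        let (ξ≡0 , η≡0) =
              across₂ i i' (λ e → ca≢cb (trans (colour-at ea) (trans (cong F.suc e) (sym (colour-at eb))))) in
        trans (ξ≡ ea eb) ξ≡0 , trans (cong toℕ (η≡ ea eb)) η≡0
      at (inj₁ _) (inj₂ _) ea eb = ξ≡ ea eb , trans (cong toℕ (η≡ ea eb)) toℕ-0ₘ
      at (inj₂ _) (inj₁ _) ea eb = ξ≡ ea eb , trans (cong toℕ (η≡ ea eb)) toℕ-0ₘ

  cut-paste : ∀ y → cut (paste y) ≈ᴾ y
  cut-paste ((ξ₁ , η₁) , (c₂ , (ξ₂ , η₂))) =
    (on-trueAt ξ₁ ξ₂ , on-trueAt η₁ η₂) , (colour≡ , (on-falseAt ξ₁ ξ₂ , on-falseAt η₁ η₂))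
    where
    on-trueAt : ∀ {A : Set} {z : A} f g i i' → combine z f g (locate p (trueAt p i)) (locate p (trueAt p i')) ≡ f i i'
    on-trueAt f g i i' rewrite locate-trueAt p i | locate-trueAt p i' = refl
    on-falseAt : ∀ {A : Set} {z : A} f g i i' → combine z f g (locate p (falseAt p i)) (locate p (falseAt p i')) ≡ g i i'
    on-falseAt f g i i' rewrite locate-falseAt p i | locate-falseAt p i' = refl
    colour≡ : ∀ i → unshift (pasteColour c₂ (locate p (falseAt p i))) ≡ c₂ i
    colour≡ i rewrite locate-falseAt p i = refl

  cut-resp : ∀ {x x'} → x ≈ᵂ x' → cut x ≈ᴾ cut x'
  cut-resp (ec , (eξ , eη)) =
    ((λ i i' → eξ (trueAt p i) (trueAt p i')) , (λ i i' → eη (trueAt p i) (trueAt p i'))) ,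
    ((λ i → cong unshift (ec (falseAt p i))) ,
     ((λ i i' → eξ (falseAt p i) (falseAt p i')) , (λ i i' → eη (falseAt p i) (falseAt p i'))))

  paste-resp : ∀ {y y'} → y ≈ᴾ y' → paste y ≈ᵂ paste y'
  paste-resp ((eξ₁ , eη₁) , (ec₂ , (eξ₂ , eη₂))) =
    (λ a → colour-resp (locate p a)) , (glue-resp F.zero eξ₁ eξ₂ , glue-resp 0ₘ eη₁ eη₂)
    where
    colour-resp : ∀ u → pasteColour _ u ≡ pasteColour _ u
    colour-resp (inj₁ _) = refl
    colour-resp (inj₂ i) = cong F.suc (ec₂ i)

  count-with-zero-class : count Whole goodWhole? ≡ countProper s n₁ * countColoured s (suc j) n₂
  count-with-zero-class = begin
    count Whole goodWhole?
      ≡⟨ count-bijection Whole Parts goodWhole? goodParts? goodWhole-resp goodParts-resp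
           cut paste cut-resp paste-resp cut-good paste-cut paste-good (λ y _ → cut-paste y) ⟩
    count Parts goodParts?
      ≡⟨ ∑-cong (FiniteSetoid.elements Parts) (λ (G , y) → indicator-× (proper? G) (coloured? y)) ⟩
    ∑ (FiniteSetoid.elements Parts) (λ (G , y) → indicator (proper? G) * indicator (coloured? y))
      ≡⟨ ∑-cartesianProduct-* (FiniteSetoid.elements (labellings s n₁))
           (FiniteSetoid.elements (colouredLabellings s (suc j) n₂)) (indicator ∘ proper?) (indicator ∘ coloured?) ⟩
    countProper s n₁ * countColoured s (suc j) n₂ ∎
    where
    goodWhole-resp : ∀ {x x'} → x ≈ᵂ x' → GoodWhole x → GoodWhole x'
    goodWhole-resp {x} {x'} e (zero-class , coloured) =
      (λ a → trans (cong isZero (sym (proj₁ e a))) (zero-class a)) , IsColouredProper-resp {x = x} {x'} e coloured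
    goodParts-resp : ∀ {y y'} → y ≈ᴾ y' → GoodParts y → GoodParts y'
    goodParts-resp {_ , y} {_ , y'} ((eξ , eη) , e) (proper , coloured) =
      IsCompleteProper-resp d eξ eη proper , IsColouredProper-resp {x = y} {y'} e coloured
    open ≡-Reasoning
    proper? = isCompleteProper? s d n₁
    coloured? = isColouredProper? s (suc j) n₂

module _ (d : ℕ) .{{_ : NonZero d}} (s j k : ℕ) where
  open Coloured d

  -- Sort the coloured labellings by the set of vertices of colour 0.
  countColoured-split : countColoured s (suc (suc j)) k ≡
    ∑ (allFuns k (true ∷ false ∷ []))
      (λ w → countProper s (countTrue (tabulate w)) * countColoured s (suc j) (countFalse (tabulate w)))
  countColoured-split = begin
    countColoured s (suc (suc j)) k
      ≡⟨ ∑-cong elements (λ x → sym (∑-indicator-≈ (finiteFun k finiteBool) (λ _ → indicator (coloured? x))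
                                                      (λ _ → refl) (zeroClass x))) ⟩
    ∑ elements (λ x → ∑ (allFuns k bits) (λ w → indicator (zeroClass x ≟ᶠ w) * indicator (coloured? x)))
      ≡⟨ ∑-swap elements (allFuns k bits) (λ x w → indicator (zeroClass x ≟ᶠ w) * indicator (coloured? x)) ⟩
    ∑ (allFuns k bits) (λ w → ∑ elements (λ x → indicator (zeroClass x ≟ᶠ w) * indicator (coloured? x)))
      ≡⟨ ∑-cong (allFuns k bits) (λ w →
           trans (∑-cong elements (λ x → sym (indicator-× (zeroClass x ≟ᶠ w) (coloured? x))))
                 (ColourSplit.count-with-zero-class d s j k w)) ⟩
    ∑ (allFuns k bits)
      (λ w → countProper s (countTrue (tabulate w)) * countColoured s (suc j) (countFalse (tabulate w))) ∎
    where
    open ≡-Reasoning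
    bits = true ∷ false ∷ []
    elements = FiniteSetoid.elements (colouredLabellings s (suc (suc j)) k)
    coloured? = isColouredProper? s (suc (suc j)) k
    _≟ᶠ_ = FiniteSetoid._≟_ (finiteFun k finiteBool)
    zeroClass : (Fin k → Fin (suc (suc j))) × Labelling s k → Fin k → Bool
    zeroClass x a = isZero (proj₁ x a)

-- Exponential generating functions

private
  /-suc-cross : ∀ a b p q → a * suc q ≡ b * suc p → + a / suc p ≡ + b / suc q
  /-suc-cross a b p q e = ℚ.fromℚᵘ-cong {ℚᵘ.mkℚᵘ (+ a) p} {ℚᵘ.mkℚᵘ (+ b) q}
    (ℚᵘ.*≡* (trans (sym (ℤ.pos-* a (suc q))) (trans (cong +_ e) (ℤ.pos-* b (suc p)))))

  /-suc-pred : ∀ a p .{{_ : NonZero p}} → + a / p ≡ + a / suc (pred p)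
  /-suc-pred a p = ℚ./-cong {+ a} {p} {+ a} {suc (pred p)} refl (sym (ℕ.suc-pred p))

  /-suc-*-/ : ∀ a b p q → (+ a / suc p) *ℚ (+ b / suc q) ≡ + (a * b) / (suc p * suc q)
  /-suc-*-/ a b p q = ℚ.toℚᵘ-injective (ℚᵘ.≃-trans (ℚ.toℚᵘ-homo-* (+ a / suc p) (+ b / suc q))
    (ℚᵘ.≃-trans (ℚᵘ.*-cong (ℚ.toℚᵘ-fromℚᵘ (ℚᵘ.mkℚᵘ (+ a) p))
                            (ℚ.toℚᵘ-fromℚᵘ (ℚᵘ.mkℚᵘ (+ b) q)))
    (ℚᵘ.≃-trans (ℚᵘ.≃-reflexive (cong₂ ℚᵘ.mkℚᵘ (sym (ℤ.pos-* a b)) refl))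
      (ℚᵘ.≃-sym (ℚ.toℚᵘ-fromℚᵘ (ℚᵘ.mkℚᵘ (+ (a * b)) (q + p * suc q)))))))

  /-suc-+-/ : ∀ a b p → (+ a / suc p) +ℚ (+ b / suc p) ≡ + (a + b) / suc p
  /-suc-+-/ a b p = ℚ.toℚᵘ-injective (ℚᵘ.≃-trans (ℚ.toℚᵘ-homo-+ (+ a / suc p) (+ b / suc p))
    (ℚᵘ.≃-trans (ℚᵘ.+-cong (ℚ.toℚᵘ-fromℚᵘ (ℚᵘ.mkℚᵘ (+ a) p))
                            (ℚ.toℚᵘ-fromℚᵘ (ℚᵘ.mkℚᵘ (+ b) p)))
    (ℚᵘ.≃-trans (ℚᵘ.*≡* cross) (ℚᵘ.≃-sym (ℚ.toℚᵘ-fromℚᵘ (ℚᵘ.mkℚᵘ (+ (a + b)) p))))))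
    where
    open ≡-Reasoning
    q = suc p
    cross : (+ a ℤ.* + q ℤ.+ + b ℤ.* + q) ℤ.* + q ≡ + (a + b) ℤ.* + (q * q)
    cross = begin
      (+ a ℤ.* + q ℤ.+ + b ℤ.* + q) ℤ.* + q
        ≡⟨ cong₂ (λ x y → (x ℤ.+ y) ℤ.* + q) (sym (ℤ.pos-* a q)) (sym (ℤ.pos-* b q)) ⟩
      (+ (a * q) ℤ.+ + (b * q)) ℤ.* + q
        ≡⟨ cong (ℤ._* + q) (sym (ℤ.pos-+ (a * q) (b * q))) ⟩
      + (a * q + b * q) ℤ.* + q
        ≡⟨ sym (ℤ.pos-* (a * q + b * q) q) ⟩
      + ((a * q + b * q) * q)
        ≡⟨ cong +_ (solve 3 (λ x y z → (x :* z :+ y :* z) :* z := (x :+ y) :* (z :* z)) refl a b q) ⟩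
      + ((a + b) * (q * q))
        ≡⟨ ℤ.pos-* (a + b) (q * q) ⟩
      + (a + b) ℤ.* + (q * q) ∎

/-cross : ∀ a b p q .{{_ : NonZero p}} .{{_ : NonZero q}} → a * q ≡ b * p → + a / p ≡ + b / q
/-cross a b p q e = trans (/-suc-pred a p) (trans (/-suc-cross a b (pred p) (pred q)
  (trans (cong (a *_) (ℕ.suc-pred q)) (trans e (cong (b *_) (sym (ℕ.suc-pred p)))))) (sym (/-suc-pred b q)))

/-*-/ : ∀ a b c p q r .{{_ : NonZero p}} .{{_ : NonZero q}} .{{_ : NonZero r}} →
  c * (p * q) ≡ (a * b) * r → (+ a / p) *ℚ (+ b / q) ≡ + c / r
/-*-/ a b c p q r e = trans (cong₂ _*ℚ_ (/-suc-pred a p) (/-suc-pred b q)) (trans (/-suc-*-/ a b (pred p) (pred q))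
  (/-cross (a * b) c (suc (pred p) * suc (pred q)) r
    (sym (trans (cong (c *_) (cong₂ _*_ (ℕ.suc-pred p) (ℕ.suc-pred q))) e))))

/-+-/ : ∀ a b c p r .{{_ : NonZero p}} .{{_ : NonZero r}} → c * p ≡ (a + b) * r → (+ a / p) +ℚ (+ b / p) ≡ + c / r
/-+-/ a b c p r e = trans (cong₂ _+ℚ_ (/-suc-pred a p) (/-suc-pred b p)) (trans (/-suc-+-/ a b (pred p))
  (/-cross (a + b) c (suc (pred p)) r (sym (trans (cong (c *_) (ℕ.suc-pred p)) e))))

sumToℕ : ℕ → (ℕ → ℕ) → ℕ
sumToℕ zero f = f 0
sumToℕ (suc n) f = sumToℕ n f + f (suc n)

sumToℕ-cong : ∀ n {f g : ℕ → ℕ} → (∀ i → i ≤ n → f i ≡ g i) → sumToℕ n f ≡ sumToℕ n g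
sumToℕ-cong zero e = e 0 z≤n
sumToℕ-cong (suc n) e = cong₂ _+_ (sumToℕ-cong n (λ i i≤n → e i (ℕ.m≤n⇒m≤1+n i≤n))) (e (suc n) ℕ.≤-refl)

sumToℕ-+ : ∀ n (f g : ℕ → ℕ) → sumToℕ n (λ i → f i + g i) ≡ sumToℕ n f + sumToℕ n g
sumToℕ-+ zero f g = refl
sumToℕ-+ (suc n) f g = trans (cong (_+ (f (suc n) + g (suc n))) (sumToℕ-+ n f g))
  (solve 4 (λ a b c d → (a :+ b) :+ (c :+ d) := (a :+ c) :+ (b :+ d)) refl (sumToℕ n f) (sumToℕ n g) (f (suc n)) (g (suc n)))

sumToℕ-head : ∀ n (f : ℕ → ℕ) → sumToℕ (suc n) f ≡ f 0 + sumToℕ n (λ i → f (suc i))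
sumToℕ-head zero f = refl
sumToℕ-head (suc n) f = trans (cong (_+ f (suc (suc n))) (sumToℕ-head n f)) (ℕ.+-assoc (f 0) _ _)

binomial-sum-suc : ∀ k (h : ℕ → ℕ → ℕ) →
  sumToℕ k (λ i → (k C i) * h (suc i) (k ∸ i)) + sumToℕ k (λ i → (k C i) * h i (suc (k ∸ i)))
    ≡ sumToℕ (suc k) (λ i → (suc k C i) * h i (suc k ∸ i))
binomial-sum-suc k h = begin
  S₁ + S₂                  ≡⟨ cong (_+_ S₁) S₂≡ ⟩
  S₁ + (g 0 + S₃)         ≡⟨ solve 3 (λ a b c → a :+ (b :+ c) := b :+ (a :+ c)) refl S₁ (g 0) S₃ ⟩
  g 0 + (S₁ + S₃)         ≡⟨ cong (_+_ (g 0)) (sym (sumToℕ-+ k _ _)) ⟩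
  g 0 + sumToℕ k (λ i → (k C i) * h (suc i) (k ∸ i) + (k C suc i) * h (suc i) (k ∸ i))
    ≡⟨ cong (_+_ (g 0)) (sumToℕ-cong k (λ i _ → pascal i)) ⟩
  g 0 + sumToℕ k (λ i → (suc k C suc i) * h (suc i) (k ∸ i))
    ≡⟨ sym (sumToℕ-head k (λ i → (suc k C i) * h i (suc k ∸ i))) ⟩
  sumToℕ (suc k) (λ i → (suc k C i) * h i (suc k ∸ i)) ∎
  where
  open ≡-Reasoning
  S₁ = sumToℕ k (λ i → (k C i) * h (suc i) (k ∸ i))
  S₂ = sumToℕ k (λ i → (k C i) * h i (suc (k ∸ i)))
  S₃ = sumToℕ k (λ i → (k C suc i) * h (suc i) (k ∸ i))
  g : ℕ → ℕ
  g zero = (k C 0) * h 0 (suc k)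
  g (suc i) = (k C suc i) * h (suc i) (k ∸ i)
  pascal : ∀ i → (k C i) * h (suc i) (k ∸ i) + (k C suc i) * h (suc i) (k ∸ i) ≡ (suc k C suc i) * h (suc i) (k ∸ i)
  pascal i = trans (sym (ℕ.*-distribʳ-+ (h (suc i) (k ∸ i)) (k C i) (k C suc i)))
                   (cong (_* h (suc i) (k ∸ i)) (nCk+nC[k+1]≡[n+1]C[k+1] k i))
  -- Reindex S₂ by i ↦ i + 1; the extra last term contains k C suc k = 0.
  S₂≡ : S₂ ≡ g 0 + S₃
  S₂≡ = trans (sumToℕ-cong k shift) (trans (sym (ℕ.+-identityʳ (sumToℕ k g)))
          (trans (cong (_+_ (sumToℕ k g)) (sym (cong (_* h (suc k) (k ∸ k)) (k>n⇒nCk≡0 (ℕ.n<1+n k)))))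
            (sumToℕ-head k g)))
    where
    shift : ∀ i → i ≤ k → (k C i) * h i (suc (k ∸ i)) ≡ g i
    shift zero _ = refl
    shift (suc i) i<k = cong (λ z → (k C suc i) * h (suc i) z) (sym (ℕ.+-∸-assoc 1 i<k))

∑-bitstrings : ∀ k (h : ℕ → ℕ → ℕ) →
  ∑ (allFuns k (true ∷ false ∷ [])) (λ w → h (countTrue (tabulate w)) (countFalse (tabulate w)))
    ≡ sumToℕ k (λ i → (k C i) * h i (k ∸ i))
∑-bitstrings zero h = trans (ℕ.+-identityʳ (h 0 0)) (sym (ℕ.*-identityˡ (h 0 0)))
∑-bitstrings (suc k) h =
  trans (∑-concatMap (allFuns k bits) (λ w → map (λ x → consF x w) bits) _)
    (trans (∑-cong (allFuns k bits) (λ w → cong (_+_ (h (suc (#T w)) (#F w))) (ℕ.+-identityʳ (h (#T w) (suc (#F w))))))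
      (trans (∑-+ (allFuns k bits) (λ w → h (suc (#T w)) (#F w)) (λ w → h (#T w) (suc (#F w))))
        (trans (cong₂ _+_ (∑-bitstrings k (λ a b → h (suc a) b)) (∑-bitstrings k (λ a b → h a (suc b))))
          (binomial-sum-suc k h))))
  where
  bits = true ∷ false ∷ []
  #T #F : (Fin k → Bool) → ℕ
  #T w = countTrue (tabulate w)
  #F w = countFalse (tabulate w)

sumTo-cong : ∀ n {f g : ℕ → ℚ} → (∀ i → i ≤ n → f i ≡ g i) → sumTo n f ≡ sumTo n g
sumTo-cong zero e = e 0 z≤n
sumTo-cong (suc n) e = cong₂ _+ℚ_ (sumTo-cong n (λ i i≤n → e i (ℕ.m≤n⇒m≤1+n i≤n))) (e (suc n) ℕ.≤-refl)

sumTo-/ : ∀ n (f : ℕ → ℕ) m .{{_ : NonZero m}} → sumTo n (λ i → + f i / m) ≡ + sumToℕ n f / m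
sumTo-/ zero f m = refl
sumTo-/ (suc n) f m =
  trans (cong (_+ℚ (+ f (suc n) / m)) (sumTo-/ n f m)) (/-+-/ (sumToℕ n f) (f (suc n)) (sumToℕ n f + f (suc n)) m m refl)

nCk*k!*[n∸k]!≡n! : ∀ {n k} → k ≤ n → (n C k) * (k ! * (n ∸ k) !) ≡ n !
nCk*k!*[n∸k]!≡n! {n} {k} k≤n =
  trans (cong (_* (k ! * (n ∸ k) !)) (nCk≡n!/k![n-k]! k≤n)) (m/n*n≡m {{_}} (k![n∸k]!∣n! k≤n))

egf-convolution : ∀ n (x y : ℕ → ℕ) →
  sumTo n (λ i → ((+ x i / i !) {{i !≢0}}) *ℚ ((+ y (n ∸ i) / (n ∸ i) !) {{(n ∸ i) !≢0}}))
    ≡ (+ sumToℕ n (λ i → (n C i) * (x i * y (n ∸ i))) / n !) {{n !≢0}}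
egf-convolution n x y = trans (sumTo-cong n term) (sumTo-/ n _ (n !) {{n !≢0}})
  where
  term : ∀ i → i ≤ n → ((+ x i / i !) {{i !≢0}}) *ℚ ((+ y (n ∸ i) / (n ∸ i) !) {{(n ∸ i) !≢0}})
                       ≡ (+ ((n C i) * (x i * y (n ∸ i))) / n !) {{n !≢0}}
  term i i≤n = /-*-/ (x i) (y (n ∸ i)) ((n C i) * (x i * y (n ∸ i))) (i !) ((n ∸ i) !) (n !)
                     {{i !≢0}} {{(n ∸ i) !≢0}} {{n !≢0}}
    (trans (solve 3 (λ c a q → (c :* a) :* q := a :* (c :* q)) refl (n C i) (x i * y (n ∸ i)) (i ! * (n ∸ i) !))
           (cong ((x i * y (n ∸ i)) *_) (nCk*k!*[n∸k]!≡n! i≤n)))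

sumToℕ-last : ∀ n (f : ℕ → ℕ) → (∀ i → i < n → f i ≡ 0) → sumToℕ n f ≡ f n
sumToℕ-last zero f _ = refl
sumToℕ-last (suc n) f vanish =
  cong (_+ f (suc n)) (trans (sumToℕ-cong n (λ i i≤n → vanish i (s≤s i≤n))) (sumToℕ-0 n))
  where
  sumToℕ-0 : ∀ n → sumToℕ n (λ _ → 0) ≡ 0
  sumToℕ-0 zero = refl
  sumToℕ-0 (suc n) = trans (ℕ.+-identityʳ _) (sumToℕ-0 n)

module Powers (d : ℕ) .{{_ : NonZero d}} (s : ℕ) where
  open Coloured d

  countColoured-1 : ∀ k → countColoured s 1 k ≡ countProper s k
  countColoured-1 k =
    trans (∑-cong (FiniteSetoid.elements (colouredLabellings s 1 k))
             (λ x → trans (indicator-⇔ (to x) (from x) (isColouredProper? s 1 k x) (isCompleteProper? s d k (proj₂ x)))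
                          (sym (ℕ.*-identityˡ _))))
      (trans (∑-cartesianProduct-* (FiniteSetoid.elements colourings) (FiniteSetoid.elements (labellings s k))
               (λ _ → 1) (λ G → indicator (isCompleteProper? s d k G)))
        (trans (cong (_* countProper s k) one-colouring) (ℕ.*-identityˡ _)))
    where
    colourings = finiteFun k (finiteFin 1)
    all-equal : (x y : Fin 1) → x ≡ y
    all-equal F.zero F.zero = refl
    to : ∀ x → IsColouredProper s 1 k x → IsCompleteProper s d k (proj₂ x)
    to (c , _) (pairs , triples , _) =
      (λ a b → pairs a b (all-equal (c a) (c b))) ,
      (λ a b e → triples a b e (all-equal (c a) (c b)) (all-equal (c b) (c e)))
    from : ∀ x → IsCompleteProper s d k (proj₂ x) → IsColouredProper s 1 k x
    from (c , _) (pairs , triples) =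
      (λ a b _ → pairs a b) , (λ a b e _ _ → triples a b e) ,
      (λ a b ca≢cb → ⊥-elim (ca≢cb (all-equal (c a) (c b))))
    one-colouring : ∑ (FiniteSetoid.elements colourings) (λ _ → 1) ≡ 1
    one-colouring =
      trans (∑-cong (FiniteSetoid.elements colourings)
               (λ c → sym (indicator-yes (all-equal F.zero ∘ c) (FiniteSetoid._≟_ colourings (λ _ → F.zero) c))))
            (FiniteSetoid.elements-exact colourings (λ _ → F.zero))

  countColoured-0 : ∀ n → 0 < n → countColoured s zero n ≡ 0
  countColoured-0 (suc n) _ =
    trans (∑-cartesianProduct (allFuns (suc n) []) (FiniteSetoid.elements (labellings s (suc n))) _)
      (trans (∑-concatMap (allFuns n []) (λ f → map (λ x → consF x f) []) _) (∑-0 (allFuns n [])))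

  countColoured-suc : ∀ j n →
    countColoured s (suc j) n ≡ sumToℕ n (λ i → (n C i) * (countProper s i * countColoured s j (n ∸ i)))
  countColoured-suc zero n = sym (trans (sumToℕ-last n _ off-diagonal) diagonal)
    where
    off-diagonal : ∀ i → i < n → (n C i) * (countProper s i * countColoured s 0 (n ∸ i)) ≡ 0
    off-diagonal i i<n =
      trans (cong (λ z → (n C i) * (countProper s i * z)) (countColoured-0 (n ∸ i) (ℕ.m<n⇒0<n∸m i<n)))
            (trans (cong ((n C i) *_) (ℕ.*-zeroʳ (countProper s i))) (ℕ.*-zeroʳ (n C i)))
    diagonal : (n C n) * (countProper s n * countColoured s 0 (n ∸ n)) ≡ countColoured s 1 n
    diagonal = begin
      (n C n) * (countProper s n * countColoured s 0 (n ∸ n))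
        ≡⟨ cong₂ (λ c m → c * (countProper s n * countColoured s 0 m)) (nCn≡1 n) (ℕ.n∸n≡0 n) ⟩
      1 * (countProper s n * 1)
        ≡⟨ trans (ℕ.*-identityˡ _) (ℕ.*-identityʳ _) ⟩
      countProper s n
        ≡⟨ sym (countColoured-1 n) ⟩
      countColoured s 1 n ∎
      where open ≡-Reasoning
  countColoured-suc (suc j) n =
    trans (countColoured-split d s j n) (∑-bitstrings n (λ a b → countProper s a * countColoured s (suc j) b))

  E^-coefficient : ∀ j n → (E d s ^PS j) n ≡ (+ countColoured s j n / n !) {{n !≢0}}
  E^-coefficient zero zero = refl
  E^-coefficient zero (suc n) =
    sym (trans (cong (λ z → (+ z / suc n !) {{suc n !≢0}}) (countColoured-0 (suc n) (s≤s z≤n)))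
               (ℚ.0/n≡0 (suc n !) {{suc n !≢0}}))
  E^-coefficient (suc j) n =
    trans (sumTo-cong n (λ i _ → cong₂ _*ℚ_ (cong (λ z → (+ z / i !) {{i !≢0}}) (U≡countProper s i))
                                            (E^-coefficient j (n ∸ i))))
      (trans (egf-convolution n (countProper s) (countColoured s j))
        (cong (λ z → (+ z / n !) {{n !≢0}}) (sym (countColoured-suc j n))))

module Recurrence (d : ℕ) .{{d≢0 : NonZero d}} (r : ℕ) where
  open Coloured d
  open Powers d r

  E-suc-coefficient : ∀ k → E d (suc r) (suc k) ≡ (+ 1 / d) *ℚ (E d r ^PS d) (suc k)
  E-suc-coefficient k = sym (begin
    (+ 1 / d) *ℚ (E d r ^PS d) (suc k)
      ≡⟨ cong ((+ 1 / d) *ℚ_) (E^-coefficient d (suc k)) ⟩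
    (+ 1 / d) *ℚ (+ countColoured r d (suc k) / suc k !) {{suc k !≢0}}
      ≡⟨ cong (λ z → (+ 1 / d) *ℚ (+ z / suc k !) {{suc k !≢0}}) (LevelSplit.countColoured≡d*countProper d r k) ⟩
    (+ 1 / d) *ℚ (+ (d * countProper (suc r) (suc k)) / suc k !) {{suc k !≢0}}
      ≡⟨ /-*-/ 1 (d * u) u d (suc k !) (suc k !) {{d≢0}} {{suc k !≢0}} {{suc k !≢0}}
           (solve 3 (λ u d m → u :* (d :* m) := (con 1 :* (d :* u)) :* m) refl u d (suc k !)) ⟩
    (+ u / suc k !) {{suc k !≢0}}
      ≡⟨ cong (λ z → (+ z / suc k !) {{suc k !≢0}}) (sym (U≡countProper (suc r) (suc k))) ⟩
    E d (suc r) (suc k) ∎)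
    where
    open ≡-Reasoning
    u = countProper (suc r) (suc k)

  E-zero-coefficient : E d (suc r) 0 ≡ (+ 1 / d) *ℚ ((E d r ^PS d) 0 +ℚ + (d ∸ 1) / 1)
  E-zero-coefficient = sym (begin
    (+ 1 / d) *ℚ ((E d r ^PS d) 0 +ℚ + (d ∸ 1) / 1)
      ≡⟨ cong (λ z → (+ 1 / d) *ℚ (z +ℚ + (d ∸ 1) / 1)) (E^-coefficient d 0) ⟩
    (+ 1 / d) *ℚ (+ 1 / 1 +ℚ + (d ∸ 1) / 1)
      ≡⟨ cong ((+ 1 / d) *ℚ_) (/-+-/ 1 (d ∸ 1) d 1 1
           (trans (ℕ.*-identityʳ d) (sym (trans (ℕ.*-identityʳ _) (ℕ.m+[n∸m]≡n (>-nonZero⁻¹ d)))))) ⟩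
    (+ 1 / d) *ℚ (+ d / 1)
      ≡⟨ /-*-/ 1 d 1 d 1 1 (solve 1 (λ d → con 1 :* (d :* con 1) := (con 1 :* d) :* con 1) refl d) ⟩
    + 1 / 1 ∎)
    where open ≡-Reasoning

lemma3p5 : (d : ℕ) .{{_ : NonZero d}} → 2 ≤ d → (r : ℕ) → (n : ℕ) →
    E d (suc r) n ≡ scalePS (+ 1 / d) ((E d r ^PS d) ⊕ constPS (+ (d ∸ 1) / 1)) n
lemma3p5 d _ r zero = Recurrence.E-zero-coefficient d r
lemma3p5 d _ r (suc k) = trans (Recurrence.E-suc-coefficient d r k) (cong ((+ 1 / d) *ℚ_) (sym (ℚ.+-identityʳ _)))
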